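{- Let $\tilde\chi:\mathrm{Sym}\to\mathrm{NCSym}$ be the linear map $\tilde\chi(m_\lambda)=\frac{\lambda!}{|\lambda|!}\sum_{A:\lambda(A)=\lambda}\mathbf{m}_A$. Then $\Delta^{\mathrm{NCSym}}\circ\tilde\chi=(\tilde\chi\otimes\tilde\chi)\circ\Delta^{\mathrm{Sym}}$.
   Context: For an integer partition $\lambda$, $|\lambda|$ is its size, $\lambda!=\prod_i\lambda_i!$ and $n_i(\lambda)$ is the number of parts equal to $i$ ($m_\emptyset=1$, $\tilde\chi(1)=\mathbf{m}_\emptyset$). A set partition $A\vdash[m]$ has blocks $A_1,\dots,A_{\ell(A)}$ ordered by increasing minimum; $\lambda(A)$ is the integer partition of block sizes. $\mathrm{NCSym}$ is the vector space with basis $\mathbf{m}_A$ over all set partitions and coproduct $\Delta^{\mathrm{NCSym}}(\mathbf{m}_A)=\sum_{S\subseteq[\ell(A)]}\mathbf{m}_{A_S}\otimes\mathbf{m}_{A_{[\ell(A)]\setminus S}}$, where $A_S$ is the standardization (replace integers by their ranks in the union) of $\{A_s:s\in S\}$. $\mathrm{Sym}$ is the algebra of symmetric functions with monomial basis $m_\lambda$ and coproduct $\Delta^{\mathrm{Sym}}(m_\lambda)=\sum_{\mu\uplus\nu=\lambda}m_\mu\otimes m_\nu$, where $\mu\uplus\nu=\lambda$ means $n_i(\mu)+n_i(\nu)=n_i(\lambda)$ for all $i$. -}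

module Defs where

open import Data.Nat using (ℕ; zero; suc; _+_; _∸_; _≤ᵇ_; _≡ᵇ_; _<_; _≥_; _⊔_; _!)
open import Data.Nat.Properties using (_!≢0; ≤-decTotalOrder)
import Data.Nat.Properties as ℕP
open import Data.Integer using (+_)
open import Data.Rational using (ℚ; 0ℚ; 1ℚ; _/_; _*_) renaming (_+_ to _+ℚ_)
open import Data.List using (List; []; _∷_; _++_; map; concatMap; foldr; filterᵇ; length; upTo; reverse)
open import Data.Nat.ListAction using (sum; product)
open import Data.List.Relation.Unary.All using (All)
open import Data.List.Relation.Unary.Linked using (Linked)
open import Data.Bool using (Bool; true; false; if_then_else_; not; _∧_)
open import Data.Maybe using (Maybe; just; nothing)
open import Data.Product using (_×_; _,_)
open import Relation.Binary.PropositionalEquality using (_≡_)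

Comb : Set → Set
Comb B = List (ℚ × B)

coeff : {B : Set} → ((x y : B) → Bool) → Comb B → B → ℚ
coeff eq [] b = 0ℚ
coeff eq ((c , x) ∷ f) b = (if eq x b then c else 0ℚ) +ℚ coeff eq f b

scale : {B : Set} → ℚ → Comb B → Comb B
scale c = map (λ { (d , x) → (c * d , x) })

linExt : {B C : Set} → (B → Comb C) → Comb B → Comb C
linExt g = concatMap (λ { (c , x) → scale c (g x) })

eqList : List ℕ → List ℕ → Bool
eqList [] [] = true
eqList [] (_ ∷ _) = false
eqList (_ ∷ _) [] = false
eqList (x ∷ xs) (y ∷ ys) = (x ≡ᵇ y) ∧ eqList xs ys

eqPair : (List ℕ × List ℕ) → (List ℕ × List ℕ) → Bool
eqPair (a , b) (c , d) = eqList a c ∧ eqList b d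

IsPartition : List ℕ → Set
IsPartition λ′ = Linked _≥_ λ′ × All (λ x → 0 < x) λ′

-- partitions of n with all parts ≤ k (fuel ≥ n suffices)
partsBounded : ℕ → ℕ → ℕ → List (List ℕ)
partsBounded _ zero _ = [] ∷ []
partsBounded zero (suc n) _ = []
partsBounded (suc f) (suc n) k =
  concatMap (λ p → map (p ∷_) (partsBounded f (suc n ∸ p) p))
            (filterᵇ (λ p → p ≤ᵇ k) (map suc (upTo (suc n))))

partitionsOf : ℕ → List (List ℕ)
partitionsOf n = partsBounded n n n

mult : ℕ → List ℕ → ℕ
mult i [] = 0
mult i (x ∷ xs) = (if i ≡ᵇ x then 1 else 0) + mult i xs

allᵇ : (ℕ → Bool) → List ℕ → Bool
allᵇ p [] = true
allᵇ p (x ∷ xs) = p x ∧ allᵇ p xs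

-- μ ⊎ ν = λ : n_i(μ) + n_i(ν) = n_i(λ) for all i (only i occurring in
-- one of the three lists need checking; for other i all counts are 0)
multUnion : List ℕ → List ℕ → List ℕ → Bool
multUnion μ ν λ′ = allᵇ (λ i → (mult i μ + mult i ν) ≡ᵇ mult i λ′) (μ ++ ν ++ λ′)

partFact : List ℕ → ℕ
partFact λ′ = product (map _! λ′)

-- Set partitions of [m], encoded as restricted growth strings:
-- entry i (0-based position = element i+1) is the index (0-based) of the
-- block containing it, blocks being ordered by increasing minimum.

rgsAux : ℕ → List (List ℕ × ℕ)
rgsAux zero = ([] , 0) ∷ []
rgsAux (suc n) =
  concatMap (λ { (s , k) → map (λ j → (s ++ (j ∷ []) , (if j ≡ᵇ k then suc k else k)))
                                (upTo (suc k)) })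
            (rgsAux n)

setPartitions : ℕ → List (List ℕ)
setPartitions m = map Data.Product.proj₁ (rgsAux m)

numBlocks : List ℕ → ℕ
numBlocks = foldr (λ x m → suc x ⊔ m) 0

countOf : ℕ → List ℕ → ℕ
countOf = mult

insertDesc : ℕ → List ℕ → List ℕ
insertDesc x [] = x ∷ []
insertDesc x (y ∷ ys) = if y ≤ᵇ x then x ∷ y ∷ ys else y ∷ insertDesc x ys

sortDesc : List ℕ → List ℕ
sortDesc = foldr insertDesc []

blockType : List ℕ → List ℕ
blockType A = sortDesc (map (λ j → countOf j A) (upTo (numBlocks A)))

-- standardization A_S for S ⊆ [ℓ(A)] given as a Bool vector over block indices
member : List Bool → ℕ → Bool
member [] _ = false
member (b ∷ bs) zero = b
member (b ∷ bs) (suc j) = member bs j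

indexOf : ℕ → List ℕ → Maybe ℕ
indexOf x [] = nothing
indexOf x (y ∷ ys) with x ≡ᵇ y
... | true = just 0
... | false with indexOf x ys
...   | just i = just (suc i)
...   | nothing = nothing

relabel : List ℕ → List ℕ → List ℕ
relabel seen [] = []
relabel seen (x ∷ xs) with indexOf x seen
... | just i = i ∷ relabel seen xs
... | nothing = length seen ∷ relabel (seen ++ (x ∷ [])) xs

standardize : List ℕ → List Bool → List ℕ
standardize A S = relabel [] (filterᵇ (member S) A)

subsets : ℕ → List (List Bool)
subsets zero = [] ∷ []
subsets (suc n) = concatMap (λ b → map (b ∷_) (subsets n)) (true ∷ false ∷ [])

-- The spaces: Sym with basis m_λ (λ : List ℕ), NCSym with basis m_A
-- (A : List ℕ restricted growth string), tensor products with basis pairs.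

Sym NCSym SymSym NCSymNCSym : Set
Sym = Comb (List ℕ)
NCSym = Comb (List ℕ)
SymSym = Comb (List ℕ × List ℕ)
NCSymNCSym = Comb (List ℕ × List ℕ)

ΔNCSymBasis : List ℕ → NCSymNCSym
ΔNCSymBasis A = map (λ S → (1ℚ , (standardize A S , standardize A (map not S))))
                    (subsets (numBlocks A))

ΔNCSym : NCSym → NCSymNCSym
ΔNCSym = linExt ΔNCSymBasis

ΔSymBasis : List ℕ → SymSym
ΔSymBasis λ′ =
  concatMap (λ k → concatMap (λ μ → map (λ ν → (1ℚ , (μ , ν)))
                                         (filterᵇ (λ ν → multUnion μ ν λ′) (partitionsOf (sum λ′ ∸ k))))
                              (partitionsOf k))
            (upTo (suc (sum λ′)))

ΔSym : Sym → SymSym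
ΔSym = linExt ΔSymBasis

χCoeff : List ℕ → ℚ
χCoeff λ′ = (+ partFact λ′ / 1) * (+ 1 / (sum λ′ !)) where instance _ = sum λ′ !≢0

χBasis : List ℕ → NCSym
χBasis λ′ = map (λ A → (χCoeff λ′ , A))
                (filterᵇ (λ A → eqList (blockType A) λ′) (setPartitions (sum λ′)))

χ : Sym → NCSym
χ = linExt χBasis

χ⊗χBasis : List ℕ × List ℕ → NCSymNCSym
χ⊗χBasis (μ , ν) =
  concatMap (λ { (a , A) → map (λ { (b , B) → (a * b , (A , B)) }) (χBasis ν) }) (χBasis μ)

χ⊗χ : SymSym → NCSymNCSym
χ⊗χ = linExt χ⊗χBasis

-- Both sides are linear, so it suffices to compare, for one partition λ of n, the coefficients
-- of m_A ⊗ m_B in Δ(χ̃ m_λ) and in (χ̃ ⊗ χ̃)(Δ m_λ).  On the left, a set partition C of type λ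
-- and a set S of its blocks contribute when (C_S, C_{Sᶜ}) = (A, B).  The blocks of C are those
-- of C_S together with those of C_{Sᶜ}, which forces λ = λ(A) ⊎ λ(B); and when A and B are set
-- partitions, the pairs (C, S) giving (A, B) are the ways of interleaving the |A| elements on
-- the A-side with the |B| elements on the B-side, so there are (n choose |A|) of them (by
-- induction on n: the element n lies on one of the two sides, which is Pascal's rule).  On the
-- right only μ = λ(A) and ν = λ(B) contribute, once each.  The coefficients
-- λ!/n! · (n choose |A|) and λ(A)!/|A|! · λ(B)!/|B|! agree because λ! = λ(A)! · λ(B)!.

module Submission where

open import Defs
open import Data.Rational using (ℚ)
open import Data.List using (List)
open import Data.List.Relation.Unary.All using (All)
open import Data.Nat using (ℕ)
open import Data.Product using (_×_; _,_; proj₂)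
open import Relation.Binary.PropositionalEquality using (_≡_)

open import Data.Bool using (Bool; true; false; if_then_else_; not; _∧_; T; T?)
open import Data.Bool.Properties using (∧-assoc; ∧-comm; ∧-identityʳ; ∧-zeroʳ; if-float)
open import Data.Empty using (⊥-elim)
import Data.Integer as ℤ
import Data.Integer.Properties as ℤ
open import Data.List using ([]; _∷_; _++_; _∷ʳ_; map; concatMap; filterᵇ; length; upTo; initLast; _∷ʳ′_)
open import Data.List.Properties using (map-++; map-∘; upTo-∷ʳ; length-++; ∷ʳ-injective; ++-identityʳ)
open import Data.List.Relation.Binary.Permutation.Propositional using (_↭_; ↭-refl; ↭-prep; ↭-swap; ↭-trans; ↭-sym)
open import Data.List.Relation.Binary.Permutation.Propositional.Properties using (All-resp-↭)
  renaming (map⁺ to ↭-map⁺)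
open import Data.List.Relation.Unary.All using ([]; _∷_)
import Data.List.Relation.Unary.All as All
open import Data.List.Relation.Unary.All.Properties using (map⁺; concat⁺; applyUpTo⁺₁; ++⁺; filter⁺)
open import Data.List.Relation.Unary.Linked using (Linked; []; [-]; _∷_)
import Data.List.Relation.Unary.Linked as Linked
open import Data.List.Relation.Unary.Linked.Properties using (Linked⇒All)
open import Data.Maybe using (just; nothing)
open import Data.Nat using (NonZero; _/_; zero; suc; _+_; _*_; _∸_; _≤_; _<_; _≥_; _≤ᵇ_; _<ᵇ_; _≡ᵇ_; z≤n; s≤s; s≤s⁻¹; _⊔_; _!)
open import Data.Nat.Combinatorics using (nCn≡1; nCk+nC[k+1]≡[n+1]C[k+1]; k![n∸k]!∣n!) renaming (_C_ to _choose_)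
open import Data.Nat.Combinatorics.Specification using (nCk≡n!/k![n-k]!)
open import Data.Nat.DivMod using (m/n*n≡m)
open import Data.Nat.ListAction using (sum; product)
open import Data.Nat.ListAction.Properties using (sum-++; sum-↭; product-++; product-↭)
open import Data.Nat.Properties
open import Algebra.Properties.CommutativeSemigroup +-commutativeSemigroup using ()
  renaming (interchange to +-interchange; xy∙z≈xz∙y to +-comm-right)
open import Data.Nat.Tactic.RingSolver using (solve-∀)
open import Data.Product using (proj₁)
open import Data.Rational using (0ℚ; 1ℚ; toℚᵘ)
import Data.Rational as ℚ
import Data.Rational.Properties as ℚ
open import Data.Rational.Properties using (toℚᵘ-injective; toℚᵘ-fromℚᵘ; toℚᵘ-homo-+; toℚᵘ-homo-*)
open import Data.Rational.Solver using (module +-*-Solver)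
open import Data.Rational.Unnormalised using (mkℚᵘ; *≡*) renaming (_≃_ to _≃ᵘ_; _/_ to _/ᵘ_)
import Data.Rational.Unnormalised.Properties as ℚᵘ
open import Data.Sum using (inj₁; inj₂)
open import Data.Unit using (tt)
open import Function using (_∘_; id)
open import Relation.Binary.Definitions using (tri<; tri≈; tri>)
open import Relation.Binary.PropositionalEquality using (refl; sym; trans; cong; cong₂; subst; _≢_; module ≡-Reasoning)
open import Relation.Nullary using (¬_; Reflects; ofʸ; ofⁿ; contradiction)
open import Relation.Nullary.Reflects using (fromEquivalence; _×-reflects_; T-reflects)

open ≡-Reasoning

private variable E F : Set

𝟙 : Bool → ℕ
𝟙 true = 1
𝟙 false = 0

𝟙-∧ : ∀ a b → 𝟙 (a ∧ b) ≡ 𝟙 a * 𝟙 b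
𝟙-∧ true b = sym (+-identityʳ (𝟙 b))
𝟙-∧ false b = refl

𝟙-if : ∀ b → (if b then 1 else 0) ≡ 𝟙 b
𝟙-if true = refl
𝟙-if false = refl

𝟙-∧⁴ : ∀ a b x y → 𝟙 (((a ∧ b) ∧ x) ∧ y) ≡ 𝟙 a * 𝟙 b * 𝟙 x * 𝟙 y
𝟙-∧⁴ a b x y rewrite 𝟙-∧ ((a ∧ b) ∧ x) y | 𝟙-∧ (a ∧ b) x | 𝟙-∧ a b = refl

𝟙-*-pos : ∀ a b → 0 < 𝟙 a * 𝟙 b → a ≡ true × b ≡ true
𝟙-*-pos true true _ = refl , refl

∧-∧-swap : ∀ a b c → (a ∧ b) ∧ c ≡ (a ∧ c) ∧ b
∧-∧-swap true b c = ∧-comm b c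
∧-∧-swap false b c = refl

∧-split : ∀ {a b} → a ∧ b ≡ true → a ≡ true × b ≡ true
∧-split {true} {true} _ = refl , refl

reflects-true : ∀ {P : Set} {b} → Reflects P b → P → b ≡ true
reflects-true (ofʸ _) _ = refl
reflects-true (ofⁿ ¬p) p = ⊥-elim (¬p p)

reflects-false : ∀ {P : Set} {b} → Reflects P b → ¬ P → b ≡ false
reflects-false (ofʸ p) ¬p = ⊥-elim (¬p p)
reflects-false (ofⁿ _) _ = refl

reflects-sound : ∀ {P : Set} {b} → Reflects P b → b ≡ true → P
reflects-sound (ofʸ p) _ = p

reflects-iff : ∀ {P Q : Set} {a b} → Reflects P a → Reflects Q b → (P → Q) → (Q → P) → a ≡ b
reflects-iff (ofʸ _) (ofʸ _) _ _ = refl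
reflects-iff (ofʸ p) (ofⁿ ¬q) P→Q _ = ⊥-elim (¬q (P→Q p))
reflects-iff (ofⁿ ¬p) (ofʸ q) _ Q→P = ⊥-elim (¬p (Q→P q))
reflects-iff (ofⁿ _) (ofⁿ _) _ _ = refl

≡ᵇ-reflects : ∀ m n → Reflects (m ≡ n) (m ≡ᵇ n)
≡ᵇ-reflects m n = fromEquivalence (≡ᵇ⇒≡ m n) (≡⇒≡ᵇ m n)

≡ᵇ-refl : ∀ n → (n ≡ᵇ n) ≡ true
≡ᵇ-refl n = reflects-true (≡ᵇ-reflects n n) refl

≡ᵇ-false : ∀ {m n} → m ≢ n → (m ≡ᵇ n) ≡ false
≡ᵇ-false = reflects-false (≡ᵇ-reflects _ _)

<ᵇ-true : ∀ {m n} → m < n → (m <ᵇ n) ≡ true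
<ᵇ-true = reflects-true (<ᵇ-reflects-< _ _)

<ᵇ-false : ∀ {m n} → ¬ m < n → (m <ᵇ n) ≡ false
<ᵇ-false = reflects-false (<ᵇ-reflects-< _ _)

<ᵇ-suc : ∀ a m → (a <ᵇ suc m) ≡ (a ≤ᵇ m)
<ᵇ-suc zero m = refl
<ᵇ-suc (suc a) m = refl

<ᵇ-suc-∸ : ∀ a b n → 𝟙 (a <ᵇ suc n) * 𝟙 (n ∸ a ≡ᵇ b) ≡ 𝟙 (a + b ≡ᵇ n)
<ᵇ-suc-∸ a b n = trans (sym (𝟙-∧ (a <ᵇ suc n) (n ∸ a ≡ᵇ b)))
  (cong 𝟙 (reflects-iff (<ᵇ-reflects-< a (suc n) ×-reflects ≡ᵇ-reflects (n ∸ a) b) (≡ᵇ-reflects (a + b) n)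
    (λ (a<1+n , n∸a≡b) → trans (cong (a +_) (sym n∸a≡b)) (m+[n∸m]≡n (s≤s⁻¹ a<1+n)))
    (λ { refl → s≤s (m≤m+n a b) , m+n∸m≡n a b })))

eqList-reflects : ∀ xs ys → Reflects (xs ≡ ys) (eqList xs ys)
eqList-reflects [] [] = ofʸ refl
eqList-reflects [] (_ ∷ _) = ofⁿ λ ()
eqList-reflects (_ ∷ _) [] = ofⁿ λ ()
eqList-reflects (x ∷ xs) (y ∷ ys) with x ≡ᵇ y | ≡ᵇ-reflects x y
... | false | ofⁿ x≢y = ofⁿ λ { refl → x≢y refl }
... | true | ofʸ refl with eqList xs ys | eqList-reflects xs ys
...   | true | ofʸ refl = ofʸ refl
...   | false | ofⁿ xs≢ys = ofⁿ λ { refl → xs≢ys refl }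

eqList-∷ʳ : ∀ xs ys r a → eqList (xs ∷ʳ r) (ys ∷ʳ a) ≡ eqList xs ys ∧ (r ≡ᵇ a)
eqList-∷ʳ xs ys r a = reflects-iff (eqList-reflects _ _) (eqList-reflects xs ys ×-reflects ≡ᵇ-reflects r a)
  (∷ʳ-injective xs ys) (λ { (refl , refl) → refl })

eqList-∷ʳ-[] : ∀ xs r → eqList (xs ∷ʳ r) [] ≡ false
eqList-∷ʳ-[] [] r = refl
eqList-∷ʳ-[] (x ∷ xs) r = refl

eqPair-reflects : ∀ p q → Reflects (p ≡ q) (eqPair p q)
eqPair-reflects (X , Y) (A , B) = reflects-iff′ (eqList-reflects X A ×-reflects eqList-reflects Y B)
  where
  reflects-iff′ : ∀ {b} → Reflects (X ≡ A × Y ≡ B) b → Reflects ((X , Y) ≡ (A , B)) b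
  reflects-iff′ (ofʸ (refl , refl)) = ofʸ refl
  reflects-iff′ (ofⁿ ¬eq) = ofⁿ λ { refl → ¬eq (refl , refl) }

𝟙-subst : ∀ {x y : E} {b} → Reflects (x ≡ y) b → (f : E → ℕ) → 𝟙 b * f x ≡ 𝟙 b * f y
𝟙-subst (ofʸ refl) f = refl
𝟙-subst (ofⁿ _) f = refl

𝟙-subst₂ : ∀ {x x₀ : E} {y y₀ : F} {a b} → Reflects (x ≡ x₀) a → Reflects (y ≡ y₀) b →
  (f : E → F → ℕ) → f x y * (𝟙 a * 𝟙 b) ≡ f x₀ y₀ * (𝟙 a * 𝟙 b)
𝟙-subst₂ (ofʸ refl) (ofʸ refl) f = refl
𝟙-subst₂ {x = x} {x₀} {y} {y₀} (ofʸ refl) (ofⁿ _) f = trans (*-zeroʳ (f x y)) (sym (*-zeroʳ (f x₀ y₀)))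
𝟙-subst₂ {x = x} {x₀} {y} {y₀} (ofⁿ _) _ f = trans (*-zeroʳ (f x y)) (sym (*-zeroʳ (f x₀ y₀)))

length-∷ʳ : ∀ (xs : List E) x → length (xs ∷ʳ x) ≡ suc (length xs)
length-∷ʳ xs x = trans (length-++ xs) (+-comm (length xs) 1)

∑ : List E → (E → ℕ) → ℕ
∑ [] g = 0
∑ (x ∷ xs) g = g x + ∑ xs g

infix 5 ∑
syntax ∑ xs (λ x → g) = ∑[ x ∈ xs ] g

∑-sum : ∀ (xs : List E) g → ∑ xs g ≡ sum (map g xs)
∑-sum [] g = refl
∑-sum (x ∷ xs) g = cong (g x +_) (∑-sum xs g)

∑-++ : ∀ (xs ys : List E) g → ∑ (xs ++ ys) g ≡ ∑ xs g + ∑ ys g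
∑-++ [] ys g = refl
∑-++ (x ∷ xs) ys g = trans (cong (g x +_) (∑-++ xs ys g)) (sym (+-assoc (g x) _ _))

∑-map : (f : F → E) (ys : List F) (g : E → ℕ) → ∑ (map f ys) g ≡ ∑ ys (g ∘ f)
∑-map f [] g = refl
∑-map f (y ∷ ys) g = cong (g (f y) +_) (∑-map f ys g)

∑-concatMap : (f : F → List E) (ys : List F) (g : E → ℕ) →
  ∑ (concatMap f ys) g ≡ ∑[ y ∈ ys ] ∑ (f y) g
∑-concatMap f [] g = refl
∑-concatMap f (y ∷ ys) g = trans (∑-++ (f y) (concatMap f ys) g) (cong (∑ (f y) g +_) (∑-concatMap f ys g))

∑-filter : ∀ p (xs : List E) g → ∑ (filterᵇ p xs) g ≡ ∑[ x ∈ xs ] 𝟙 (p x) * g x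
∑-filter p [] g = refl
∑-filter p (x ∷ xs) g with p x
... | true = cong₂ _+_ (sym (+-identityʳ (g x))) (∑-filter p xs g)
... | false = ∑-filter p xs g

∑-cong : ∀ (xs : List E) {g h} → (∀ x → g x ≡ h x) → ∑ xs g ≡ ∑ xs h
∑-cong [] g≗h = refl
∑-cong (x ∷ xs) g≗h = cong₂ _+_ (g≗h x) (∑-cong xs g≗h)

∑-congᴬ : ∀ {P : E → Set} {xs g h} → All P xs → (∀ x → P x → g x ≡ h x) → ∑ xs g ≡ ∑ xs h
∑-congᴬ [] _ = refl
∑-congᴬ {xs = x ∷ _} (px ∷ pxs) g≗h = cong₂ _+_ (g≗h x px) (∑-congᴬ pxs g≗h)

∑-zero : ∀ (xs : List E) {g} → (∀ x → g x ≡ 0) → ∑ xs g ≡ 0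
∑-zero [] _ = refl
∑-zero (x ∷ xs) g≡0 = cong₂ _+_ (g≡0 x) (∑-zero xs g≡0)

∑-+ : ∀ (xs : List E) g h → ∑[ x ∈ xs ] (g x + h x) ≡ ∑ xs g + ∑ xs h
∑-+ [] g h = refl
∑-+ (x ∷ xs) g h = trans (cong (g x + h x +_) (∑-+ xs g h)) (+-interchange (g x) (h x) _ _)

∑-*ˡ : ∀ c (xs : List E) g → ∑[ x ∈ xs ] c * g x ≡ c * ∑ xs g
∑-*ˡ c [] g = sym (*-zeroʳ c)
∑-*ˡ c (x ∷ xs) g = trans (cong (c * g x +_) (∑-*ˡ c xs g)) (sym (*-distribˡ-+ c (g x) _))

∑-*ʳ : ∀ c (xs : List E) g → ∑[ x ∈ xs ] g x * c ≡ ∑ xs g * c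
∑-*ʳ c xs g = trans (∑-cong xs (λ x → *-comm (g x) c)) (trans (∑-*ˡ c xs g) (*-comm c _))

∑-swap : (xs : List E) (ys : List F) (g : E → F → ℕ) → ∑[ x ∈ xs ] ∑[ y ∈ ys ] g x y ≡ ∑[ y ∈ ys ] ∑[ x ∈ xs ] g x y
∑-swap [] ys g = sym (∑-zero ys (λ _ → refl))
∑-swap (x ∷ xs) ys g = trans (cong (∑ ys (g x) +_) (∑-swap xs ys g)) (sym (∑-+ ys (g x) _))

∑-upTo-suc : ∀ k h → ∑ (upTo (suc k)) h ≡ ∑ (upTo k) h + h k
∑-upTo-suc k h = begin
  ∑ (upTo (suc k)) h      ≡⟨ cong (λ l → ∑ l h) (upTo-∷ʳ k) ⟨
  ∑ (upTo k ∷ʳ k) h       ≡⟨ ∑-++ (upTo k) (k ∷ []) h ⟩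
  ∑ (upTo k) h + (h k + 0) ≡⟨ cong (∑ (upTo k) h +_) (+-identityʳ (h k)) ⟩
  ∑ (upTo k) h + h k      ∎

∑-upTo-≡ᵇ : ∀ k x → ∑[ j ∈ upTo k ] 𝟙 (j ≡ᵇ x) ≡ 𝟙 (x <ᵇ k)
∑-upTo-≡ᵇ zero x = refl
∑-upTo-≡ᵇ (suc k) x = trans (∑-upTo-suc k _) (trans (cong (_+ 𝟙 (k ≡ᵇ x)) (∑-upTo-≡ᵇ k x)) last)
  where
  last : 𝟙 (x <ᵇ k) + 𝟙 (k ≡ᵇ x) ≡ 𝟙 (x <ᵇ suc k)
  last with <-cmp x k
  ... | tri< x<k x≢k _ rewrite <ᵇ-true x<k | ≡ᵇ-false (x≢k ∘ sym) | <ᵇ-true (m<n⇒m<1+n x<k) = refl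
  ... | tri≈ x≮x refl _ rewrite <ᵇ-false x≮x | ≡ᵇ-refl x | <ᵇ-true (n<1+n x) = refl
  ... | tri> x≮k x≢k k<x rewrite <ᵇ-false x≮k | ≡ᵇ-false (x≢k ∘ sym) | <ᵇ-false (<⇒≱ k<x ∘ s≤s⁻¹) = refl

∑-𝟙-subst : ∀ {eq : E → E → Bool} → (∀ p q → Reflects (p ≡ q) (eq p q)) →
  ∀ xs x (f : E → ℕ) → ∑[ p ∈ xs ] 𝟙 (eq p x) * f p ≡ (∑[ p ∈ xs ] 𝟙 (eq p x)) * f x
∑-𝟙-subst {eq = eq} eq-reflects xs x f =
  trans (∑-cong xs λ p → 𝟙-subst (eq-reflects p x) f) (∑-*ʳ (f x) xs λ p → 𝟙 (eq p x))

∑-upTo-suc-≡ᵇ : ∀ m a → ∑[ j ∈ upTo (suc m) ] 𝟙 (j ≡ᵇ a) ≡ 𝟙 (a ≤ᵇ m)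
∑-upTo-suc-≡ᵇ m a = trans (∑-upTo-≡ᵇ (suc m) a) (cong 𝟙 (<ᵇ-suc a m))

∑-upTo-pinned : ∀ {eq : E → E → Bool} → (∀ p q → Reflects (p ≡ q) (eq p q)) →
  ∀ x y (bound : E → ℕ) a → ∑[ r ∈ upTo (suc (bound x)) ] 𝟙 (eq x y) * 𝟙 (r ≡ᵇ a) ≡ 𝟙 (a ≤ᵇ bound y) * 𝟙 (eq x y)
∑-upTo-pinned {eq = eq} eq-reflects x y bound a = begin
  ∑[ r ∈ upTo (suc (bound x)) ] 𝟙 (eq x y) * 𝟙 (r ≡ᵇ a)
    ≡⟨ ∑-*ˡ (𝟙 (eq x y)) (upTo (suc (bound x))) (λ r → 𝟙 (r ≡ᵇ a)) ⟩
  𝟙 (eq x y) * (∑[ r ∈ upTo (suc (bound x)) ] 𝟙 (r ≡ᵇ a))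
    ≡⟨ cong (𝟙 (eq x y) *_) (∑-upTo-suc-≡ᵇ (bound x) a) ⟩
  𝟙 (eq x y) * 𝟙 (a ≤ᵇ bound x)
    ≡⟨ 𝟙-subst (eq-reflects x y) (λ z → 𝟙 (a ≤ᵇ bound z)) ⟩
  𝟙 (eq x y) * 𝟙 (a ≤ᵇ bound y)
    ≡⟨ *-comm (𝟙 (eq x y)) _ ⟩
  𝟙 (a ≤ᵇ bound y) * 𝟙 (eq x y) ∎

-- Restricted growth strings

afterEntry : ℕ → ℕ → ℕ
afterEntry m x = if x ≡ᵇ m then suc m else m

afterEntry-old : ∀ {m x} → x < m → afterEntry m x ≡ m
afterEntry-old x<m rewrite ≡ᵇ-false (<⇒≢ x<m) = refl

afterEntry-new : ∀ m → afterEntry m m ≡ suc m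
afterEntry-new m rewrite ≡ᵇ-refl m = refl

-- isRGSFrom m xs: xs continues a restricted growth string that has already opened the blocks
-- 0, …, m - 1; blocksFrom m xs is the number of blocks open at its end.
isRGSFrom : ℕ → List ℕ → Bool
isRGSFrom m [] = true
isRGSFrom m (x ∷ xs) = (x ≤ᵇ m) ∧ isRGSFrom (afterEntry m x) xs

blocksFrom : ℕ → List ℕ → ℕ
blocksFrom m [] = m
blocksFrom m (x ∷ xs) = blocksFrom (afterEntry m x) xs

isRGS : List ℕ → Bool
isRGS = isRGSFrom 0

data Entry (m : ℕ) : ℕ → ℕ → Set where
  old : ∀ {x} → x < m → Entry m x m
  new : Entry m m (suc m)

entry : ∀ m x → x ≤ m → Entry m x (afterEntry m x)
entry m x x≤m with m≤n⇒m<n∨m≡n x≤m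
... | inj₁ x<m rewrite afterEntry-old x<m = old x<m
... | inj₂ refl rewrite afterEntry-new x = new

isRGSFrom-head : ∀ m x xs → isRGSFrom m (x ∷ xs) ≡ true → x ≤ m
isRGSFrom-head m x xs ok = reflects-sound (≤ᵇ-reflects-≤ x m) (proj₁ (∧-split ok))

isRGSFrom-tail : ∀ m x xs → isRGSFrom m (x ∷ xs) ≡ true → isRGSFrom (afterEntry m x) xs ≡ true
isRGSFrom-tail m x xs ok = proj₂ (∧-split {x ≤ᵇ m} ok)

isRGSFrom-∷ʳ : ∀ m xs j → isRGSFrom m (xs ∷ʳ j) ≡ isRGSFrom m xs ∧ (j ≤ᵇ blocksFrom m xs)
isRGSFrom-∷ʳ m [] j = ∧-identityʳ _
isRGSFrom-∷ʳ m (x ∷ xs) j =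
  trans (cong ((x ≤ᵇ m) ∧_) (isRGSFrom-∷ʳ (afterEntry m x) xs j)) (sym (∧-assoc (x ≤ᵇ m) _ _))

isRGS-∷ʳ : ∀ A a → isRGS (A ∷ʳ a) ≡ isRGS A ∧ (a ≤ᵇ blocksFrom 0 A)
isRGS-∷ʳ = isRGSFrom-∷ʳ 0

blocksFrom-∷ʳ : ∀ m xs j → blocksFrom m (xs ∷ʳ j) ≡ afterEntry (blocksFrom m xs) j
blocksFrom-∷ʳ m [] j = refl
blocksFrom-∷ʳ m (x ∷ xs) j = blocksFrom-∷ʳ (afterEntry m x) xs j

≤-afterEntry : ∀ m x → m ≤ afterEntry m x
≤-afterEntry m x with x ≡ᵇ m
... | true = n≤1+n m
... | false = ≤-refl

≤-blocksFrom : ∀ m xs → m ≤ blocksFrom m xs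
≤-blocksFrom m [] = ≤-refl
≤-blocksFrom m (x ∷ xs) = ≤-trans (≤-afterEntry m x) (≤-blocksFrom (afterEntry m x) xs)

<-afterEntry : ∀ {m x} → x ≤ m → x < afterEntry m x
<-afterEntry {m} {x} x≤m with afterEntry m x | entry m x x≤m
... | _ | old x<m = x<m
... | _ | new = n<1+n m

entries<blocks : ∀ m xs → isRGSFrom m xs ≡ true → All (_< blocksFrom m xs) xs
entries<blocks m [] _ = []
entries<blocks m (x ∷ xs) ok =
  <-≤-trans (<-afterEntry (isRGSFrom-head m x xs ok)) (≤-blocksFrom _ xs) ∷ entries<blocks _ xs (isRGSFrom-tail m x xs ok)

numBlocks-isRGSFrom : ∀ m xs → isRGSFrom m xs ≡ true → m ⊔ numBlocks xs ≡ blocksFrom m xs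
numBlocks-isRGSFrom m [] _ = ⊔-identityʳ m
numBlocks-isRGSFrom m (x ∷ xs) ok with afterEntry m x | entry m x (isRGSFrom-head m x xs ok) | isRGSFrom-tail m x xs ok
... | _ | old x<m | ok′ = begin
  m ⊔ (suc x ⊔ numBlocks xs) ≡⟨ ⊔-assoc m (suc x) _ ⟨
  m ⊔ suc x ⊔ numBlocks xs   ≡⟨ cong (_⊔ numBlocks xs) (m≥n⇒m⊔n≡m x<m) ⟩
  m ⊔ numBlocks xs           ≡⟨ numBlocks-isRGSFrom m xs ok′ ⟩
  blocksFrom m xs            ∎
... | _ | new | ok′ = begin
  m ⊔ (suc m ⊔ numBlocks xs) ≡⟨ ⊔-assoc m (suc m) _ ⟨
  m ⊔ suc m ⊔ numBlocks xs   ≡⟨ cong (_⊔ numBlocks xs) (m≤n⇒m⊔n≡n (n≤1+n m)) ⟩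
  suc m ⊔ numBlocks xs       ≡⟨ numBlocks-isRGSFrom (suc m) xs ok′ ⟩
  blocksFrom (suc m) xs      ∎

numBlocks-isRGS : ∀ xs → isRGS xs ≡ true → numBlocks xs ≡ blocksFrom 0 xs
numBlocks-isRGS = numBlocks-isRGSFrom 0

countOf-pos : ∀ m xs {j} → isRGSFrom m xs ≡ true → m ≤ j → j < blocksFrom m xs → 0 < countOf j xs
countOf-pos m [] _ m≤j j<m = ⊥-elim (<⇒≱ j<m m≤j)
countOf-pos m (x ∷ xs) {j} ok m≤j j<b with j ≡ᵇ x | ≡ᵇ-reflects j x
... | true | _ = s≤s z≤n
... | false | ofⁿ j≢x with afterEntry m x | entry m x (isRGSFrom-head m x xs ok) | isRGSFrom-tail m x xs ok | j<b
...   | _ | old _ | ok′ | j<b′ = countOf-pos m xs ok′ m≤j j<b′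
...   | _ | new | ok′ | j<b′ = countOf-pos (suc m) xs ok′ (≤∧≢⇒< m≤j (j≢x ∘ sym)) j<b′

RGSAuxInvariant : List ℕ × ℕ → Set
RGSAuxInvariant (s , k) = isRGS s ≡ true × k ≡ blocksFrom 0 s

rgsAux-invariant : ∀ n → All RGSAuxInvariant (rgsAux n)
rgsAux-invariant zero = (refl , refl) ∷ []
rgsAux-invariant (suc n) = concat⁺ (map⁺ (All.map (λ { {s , k} inv → extend s k inv }) (rgsAux-invariant n)))
  where
  extend : ∀ s k → RGSAuxInvariant (s , k) → All RGSAuxInvariant (map (λ j → (s ∷ʳ j , afterEntry k j)) (upTo (suc k)))
  extend s k (ok , refl) = map⁺ (applyUpTo⁺₁ id (suc k) λ {j} j≤k →
    trans (isRGSFrom-∷ʳ 0 s j) (cong₂ _∧_ ok (reflects-true (≤ᵇ-reflects-≤ j k) (s≤s⁻¹ j≤k)))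
    , sym (blocksFrom-∷ʳ 0 s j))

setPartitions-isRGS : ∀ n → All (λ C → isRGS C ≡ true) (setPartitions n)
setPartitions-isRGS n = map⁺ (All.map proj₁ (rgsAux-invariant n))

∑-setPartitions-suc : ∀ n (g : List ℕ → ℕ) →
  ∑ (setPartitions (suc n)) g ≡ ∑[ C ∈ setPartitions n ] ∑[ j ∈ upTo (suc (blocksFrom 0 C)) ] g (C ∷ʳ j)
∑-setPartitions-suc n g =
  trans (∑-map proj₁ (rgsAux (suc n)) g)
  (trans (∑-concatMap _ (rgsAux n) (g ∘ proj₁))
  (trans (∑-congᴬ (rgsAux-invariant n) λ { (s , k) (_ , refl) → ∑-map _ (upTo (suc k)) (g ∘ proj₁) })
         (sym (∑-map proj₁ (rgsAux n) λ C → ∑[ j ∈ upTo (suc (blocksFrom 0 C)) ] g (C ∷ʳ j)))))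

∑-setPartitions-≡ : ∀ n A → ∑[ C ∈ setPartitions n ] 𝟙 (eqList C A) ≡ 𝟙 (isRGS A ∧ (length A ≡ᵇ n))
∑-setPartitions-≡ zero [] = refl
∑-setPartitions-≡ zero (x ∷ A) = cong 𝟙 (sym (∧-zeroʳ _))
∑-setPartitions-≡ (suc n) A with initLast A
... | [] = trans (∑-setPartitions-suc n _) (∑-zero (setPartitions n) λ C →
               ∑-zero (upTo (suc (blocksFrom 0 C))) λ j → cong 𝟙 (eqList-∷ʳ-[] C j))
... | A₀ ∷ʳ′ a = begin
  ∑ (setPartitions (suc n)) (λ C → 𝟙 (eqList C (A₀ ∷ʳ a)))
    ≡⟨ ∑-setPartitions-suc n (λ C → 𝟙 (eqList C (A₀ ∷ʳ a))) ⟩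
  ∑[ C ∈ setPartitions n ] ∑[ j ∈ upTo (suc (blocksFrom 0 C)) ] 𝟙 (eqList (C ∷ʳ j) (A₀ ∷ʳ a))
    ≡⟨ ∑-cong (setPartitions n) (λ C → trans
         (∑-cong (upTo (suc (blocksFrom 0 C))) λ j → trans (cong 𝟙 (eqList-∷ʳ C A₀ j a)) (𝟙-∧ (eqList C A₀) (j ≡ᵇ a)))
         (∑-upTo-pinned eqList-reflects C A₀ (blocksFrom 0) a)) ⟩
  ∑[ C ∈ setPartitions n ] 𝟙 (a ≤ᵇ blocksFrom 0 A₀) * 𝟙 (eqList C A₀)
    ≡⟨ ∑-*ˡ (𝟙 (a ≤ᵇ blocksFrom 0 A₀)) (setPartitions n) (λ C → 𝟙 (eqList C A₀)) ⟩
  𝟙 (a ≤ᵇ blocksFrom 0 A₀) * (∑[ C ∈ setPartitions n ] 𝟙 (eqList C A₀))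
    ≡⟨ cong (𝟙 (a ≤ᵇ blocksFrom 0 A₀) *_) (∑-setPartitions-≡ n A₀) ⟩
  𝟙 (a ≤ᵇ blocksFrom 0 A₀) * 𝟙 (isRGS A₀ ∧ (length A₀ ≡ᵇ n))
    ≡⟨ 𝟙-∧ (a ≤ᵇ blocksFrom 0 A₀) (isRGS A₀ ∧ (length A₀ ≡ᵇ n)) ⟨
  𝟙 ((a ≤ᵇ blocksFrom 0 A₀) ∧ (isRGS A₀ ∧ (length A₀ ≡ᵇ n)))
    ≡⟨ cong 𝟙 (∧-assoc (a ≤ᵇ blocksFrom 0 A₀) (isRGS A₀) _) ⟨
  𝟙 (((a ≤ᵇ blocksFrom 0 A₀) ∧ isRGS A₀) ∧ (length A₀ ≡ᵇ n))
    ≡⟨ cong₂ (λ u l → 𝟙 (u ∧ (l ≡ᵇ suc n))) (trans (∧-comm _ (isRGS A₀)) (sym (isRGS-∷ʳ A₀ a))) (sym (length-∷ʳ A₀ a)) ⟩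
  𝟙 (isRGS (A₀ ∷ʳ a) ∧ (length (A₀ ∷ʳ a) ≡ᵇ suc n)) ∎

-- Standardization

rank : (ℕ → Bool) → ℕ → ℕ
rank P zero = 0
rank P (suc j) = if P j then suc (rank P j) else rank P j

selected : (ℕ → Bool) → ℕ → List ℕ
selected P zero = []
selected P (suc m) = if P m then selected P m ∷ʳ m else selected P m

stdBy : (ℕ → Bool) → List ℕ → List ℕ
stdBy P C = map (rank P) (filterᵇ P C)

module _ (P : ℕ → Bool) where

  rank-suc : ∀ j → rank P j ≤ rank P (suc j)
  rank-suc j with P j
  ... | true = n≤1+n _
  ... | false = ≤-refl

  rank-suc-true : ∀ {j} → P j ≡ true → rank P (suc j) ≡ suc (rank P j)
  rank-suc-true Pj rewrite Pj = refl

  rank-suc-false : ∀ {j} → P j ≡ false → rank P (suc j) ≡ rank P j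
  rank-suc-false Pj rewrite Pj = refl

  rank-mono : ∀ {x y} → x ≤ y → rank P x ≤ rank P y
  rank-mono {y = zero} z≤n = z≤n
  rank-mono {x} {suc y} x≤1+y with m≤n⇒m<n∨m≡n x≤1+y
  ... | inj₁ x<1+y = ≤-trans (rank-mono (s≤s⁻¹ x<1+y)) (rank-suc y)
  ... | inj₂ refl = ≤-refl

  rank-strict : ∀ {x y} → x < y → P x ≡ true → rank P x < rank P y
  rank-strict x<y Px = subst (_≤ _) (rank-suc-true Px) (rank-mono x<y)

  rank-injective : ∀ {x y} → P x ≡ true → P y ≡ true → rank P x ≡ rank P y → x ≡ y
  rank-injective {x} {y} Px Py eq with <-cmp x y
  ... | tri< x<y _ _ = ⊥-elim (<⇒≢ (rank-strict x<y Px) eq)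
  ... | tri≈ _ x≡y _ = x≡y
  ... | tri> _ _ y<x = ⊥-elim (<⇒≢ (rank-strict y<x Py) (sym eq))

  length-selected : ∀ m → length (selected P m) ≡ rank P m
  length-selected zero = refl
  length-selected (suc m) with P m
  ... | true = trans (length-∷ʳ (selected P m) m) (cong suc (length-selected m))
  ... | false = length-selected m

  selected< : ∀ m → All (_< m) (selected P m)
  selected<  zero = []
  selected< (suc m) with P m
  ... | true = ++⁺ (All.map m<n⇒m<1+n (selected< m)) (n<1+n m ∷ [])
  ... | false = All.map m<n⇒m<1+n (selected< m)

indexOf-absent : ∀ {x} ys → All (_≢ x) ys → indexOf x ys ≡ nothing
indexOf-absent [] [] = refl
indexOf-absent {x} (y ∷ ys) (y≢x ∷ ys≢x) rewrite ≡ᵇ-false (y≢x ∘ sym) | indexOf-absent ys ys≢x = refl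

indexOf-++ : ∀ x xs ys {i} → indexOf x xs ≡ just i → indexOf x (xs ++ ys) ≡ just i
indexOf-++ x (y ∷ xs) ys eq with x ≡ᵇ y
... | true = eq
... | false with indexOf x xs in eq′
...   | just _ rewrite indexOf-++ x xs ys eq′ = eq

indexOf-∷ʳ : ∀ x xs → indexOf x xs ≡ nothing → indexOf x (xs ∷ʳ x) ≡ just (length xs)
indexOf-∷ʳ x [] _ rewrite ≡ᵇ-refl x = refl
indexOf-∷ʳ x (y ∷ xs) eq with x ≡ᵇ y
... | false with indexOf x xs in eq′
...   | nothing rewrite indexOf-∷ʳ x xs eq′ = refl

indexOf-selected : ∀ P {x} m → P x ≡ true → x < m → indexOf x (selected P m) ≡ just (rank P x)
indexOf-selected P {x} (suc m) Px x<1+m with m≤n⇒m<n∨m≡n (s≤s⁻¹ x<1+m)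
... | inj₁ x<m with P m
...   | true = indexOf-++ x (selected P m) (m ∷ []) (indexOf-selected P m Px x<m)
...   | false = indexOf-selected P m Px x<m
indexOf-selected P {x} (suc m) Px x<1+m | inj₂ refl rewrite Px =
  trans (indexOf-∷ʳ x (selected P x) (indexOf-absent (selected P x) (All.map <⇒≢ (selected< P x))))
        (cong just (length-selected P x))

relabel-selected : ∀ P m C → isRGSFrom m C ≡ true → relabel (selected P m) (filterᵇ P C) ≡ stdBy P C
relabel-selected P m [] _ = refl
relabel-selected P m (x ∷ C) ok
  with afterEntry m x | entry m x (isRGSFrom-head m x C ok) | isRGSFrom-tail m x C ok | P x in Px
... | _ | old x<m | ok′ | true rewrite indexOf-selected P m Px x<m =
  cong (rank P x ∷_) (relabel-selected P m C ok′)
... | _ | old x<m | ok′ | false = relabel-selected P m C ok′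
... | _ | new | ok′ | true
  rewrite indexOf-absent (selected P m) (All.map <⇒≢ (selected< P m)) =
  cong₂ _∷_ (length-selected P m) (subst (λ s → relabel s (filterᵇ P C) ≡ stdBy P C) selected-1+m (relabel-selected P (suc m) C ok′))
  where
  selected-1+m : selected P (suc m) ≡ selected P m ∷ʳ m
  selected-1+m rewrite Px = refl
... | _ | new | ok′ | false =
  subst (λ s → relabel s (filterᵇ P C) ≡ stdBy P C) selected-1+m (relabel-selected P (suc m) C ok′)
  where
  selected-1+m : selected P (suc m) ≡ selected P m
  selected-1+m rewrite Px = refl

stdBy-∷ʳ : ∀ P C j → stdBy P (C ∷ʳ j) ≡ stdBy P C ++ (if P j then rank P j ∷ [] else [])
stdBy-∷ʳ P [] j with P j
... | true = refl
... | false = refl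
stdBy-∷ʳ P (x ∷ C) j with P x
... | true = cong (rank P x ∷_) (stdBy-∷ʳ P C j)
... | false = stdBy-∷ʳ P C j

rank-cong : ∀ {P Q k} → (∀ i → i < k → P i ≡ Q i) → ∀ {j} → j ≤ k → rank P j ≡ rank Q j
rank-cong P≗Q {zero} _ = refl
rank-cong P≗Q {suc j} j<k rewrite P≗Q j j<k | rank-cong P≗Q (<⇒≤ j<k) = refl

stdBy-cong : ∀ {P Q k} → (∀ i → i < k → P i ≡ Q i) → ∀ {C} → All (_< k) C → stdBy P C ≡ stdBy Q C
stdBy-cong P≗Q [] = refl
stdBy-cong {P} {Q} P≗Q {x ∷ C} (x<k ∷ C<k) rewrite P≗Q x x<k with Q x
... | true = cong₂ _∷_ (rank-cong P≗Q (<⇒≤ x<k)) (stdBy-cong P≗Q C<k)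
... | false = stdBy-cong P≗Q C<k

stdBy-isRGSFrom : ∀ P m C → isRGSFrom m C ≡ true →
  isRGSFrom (rank P m) (stdBy P C) ≡ true × blocksFrom (rank P m) (stdBy P C) ≡ rank P (blocksFrom m C)
stdBy-isRGSFrom P m [] _ = refl , refl
stdBy-isRGSFrom P m (x ∷ C) ok
  with afterEntry m x | entry m x (isRGSFrom-head m x C ok) | isRGSFrom-tail m x C ok | P x in Px
... | _ | old x<m | ok′ | true
  rewrite afterEntry-old (rank-strict P x<m Px) | reflects-true (≤ᵇ-reflects-≤ _ _) (<⇒≤ (rank-strict P x<m Px)) =
  stdBy-isRGSFrom P m C ok′
... | _ | old x<m | ok′ | false = stdBy-isRGSFrom P m C ok′
... | _ | new | ok′ | true rewrite afterEntry-new (rank P m) | reflects-true (≤ᵇ-reflects-≤ _ _) (≤-refl {rank P m}) =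
  subst (λ r → isRGSFrom r (stdBy P C) ≡ true × blocksFrom r (stdBy P C) ≡ rank P (blocksFrom (suc m) C))
        (rank-suc-true P Px) (stdBy-isRGSFrom P (suc m) C ok′)
... | _ | new | ok′ | false =
  subst (λ r → isRGSFrom r (stdBy P C) ≡ true × blocksFrom r (stdBy P C) ≡ rank P (blocksFrom (suc m) C))
        (rank-suc-false P Px) (stdBy-isRGSFrom P (suc m) C ok′)

countOf-stdBy : ∀ P {j} C → P j ≡ true → countOf (rank P j) (stdBy P C) ≡ countOf j C
countOf-stdBy P [] _ = refl
countOf-stdBy P {j} (x ∷ C) Pj with P x in Px
... | true = cong₂ _+_ (cong (λ b → if b then 1 else 0) same-block) (countOf-stdBy P C Pj)
  where
  same-block : (rank P j ≡ᵇ rank P x) ≡ (j ≡ᵇ x)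
  same-block = reflects-iff (≡ᵇ-reflects _ _) (≡ᵇ-reflects j x) (rank-injective P Pj Px) (cong (rank P))
... | false rewrite ≡ᵇ-false {j} {x} (λ { refl → contradiction (trans (sym Pj) Px) λ () }) = countOf-stdBy P C Pj

member-not : ∀ S {j} → j < length S → member (map not S) j ≡ not (member S j)
member-not (b ∷ S) {zero} _ = refl
member-not (b ∷ S) {suc j} j<|S| = member-not S (s≤s⁻¹ j<|S|)

member-∷ʳ-< : ∀ S b {j} → j < length S → member (S ∷ʳ b) j ≡ member S j
member-∷ʳ-< (c ∷ S) b {zero} _ = refl
member-∷ʳ-< (c ∷ S) b {suc j} j<|S| = member-∷ʳ-< S b (s≤s⁻¹ j<|S|)

member-∷ʳ-length : ∀ S b → member (S ∷ʳ b) (length S) ≡ b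
member-∷ʳ-length [] b = refl
member-∷ʳ-length (c ∷ S) b = member-∷ʳ-length S b

subsets-length : ∀ k → All (λ S → length S ≡ k) (subsets k)
subsets-length zero = refl ∷ []
subsets-length (suc k) = ++⁺ (with-head true) (++⁺ (with-head false) [])
  where
  with-head : ∀ b → All (λ S → length S ≡ suc k) (map (b ∷_) (subsets k))
  with-head b = map⁺ (All.map (cong suc) (subsets-length k))

restrict restrictᶜ : List Bool → List ℕ → List ℕ
restrict S C = stdBy (member S) C
restrictᶜ S C = stdBy (not ∘ member S) C

standardize-restrict : ∀ C S → isRGS C ≡ true → standardize C S ≡ restrict S C
standardize-restrict C S = relabel-selected (member S) 0 C

standardize-restrictᶜ : ∀ C S → isRGS C ≡ true → length S ≡ blocksFrom 0 C →
  standardize C (map not S) ≡ restrictᶜ S C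
standardize-restrictᶜ C S ok |S| = trans (relabel-selected (member (map not S)) 0 C ok)
  (stdBy-cong (λ i i<k → member-not S (subst (i <_) (sym |S|) i<k)) (entries<blocks 0 C ok))

insertDesc-↭ : ∀ x ys → insertDesc x ys ↭ x ∷ ys
insertDesc-↭ x [] = ↭-refl
insertDesc-↭ x (y ∷ ys) with y ≤ᵇ x
... | true = ↭-refl
... | false = ↭-trans (↭-prep y (insertDesc-↭ x ys)) (↭-swap y x ↭-refl)

sortDesc-↭ : ∀ xs → sortDesc xs ↭ xs
sortDesc-↭ [] = ↭-refl
sortDesc-↭ (x ∷ xs) = ↭-trans (insertDesc-↭ x (sortDesc xs)) (↭-prep x (sortDesc-↭ xs))

insertDesc-sorted : ∀ x ys → Linked _≥_ ys → Linked _≥_ (insertDesc x ys)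
insertDesc-sorted x [] _ = [-]
insertDesc-sorted x (y ∷ ys) ys↘ with y ≤ᵇ x in y≤ᵇx
... | true = ≤ᵇ⇒≤ y x (subst T (sym y≤ᵇx) _) ∷ ys↘
... | false = below y ys (<⇒≤ x<y) ys↘
  where
  x<y : x < y
  x<y = ≰⇒> (λ y≤x → contradiction (trans (sym (reflects-true (≤ᵇ-reflects-≤ y x) y≤x)) y≤ᵇx) λ ())
  below : ∀ y ys → x ≤ y → Linked _≥_ (y ∷ ys) → Linked _≥_ (y ∷ insertDesc x ys)
  below y [] x≤y _ = x≤y ∷ [-]
  below y (z ∷ zs) x≤y (z≤y ∷ zs↘) with z ≤ᵇ x in z≤ᵇx
  ... | true = x≤y ∷ ≤ᵇ⇒≤ z x (subst T (sym z≤ᵇx) _) ∷ zs↘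
  ... | false = z≤y ∷ below z zs (<⇒≤ (≰⇒> λ z≤x → contradiction (trans (sym (reflects-true (≤ᵇ-reflects-≤ z x) z≤x)) z≤ᵇx) λ ())) zs↘

sortDesc-sorted : ∀ xs → Linked _≥_ (sortDesc xs)
sortDesc-sorted [] = []
sortDesc-sorted (x ∷ xs) = insertDesc-sorted x (sortDesc xs) (sortDesc-sorted xs)

mult-∑ : ∀ i xs → mult i xs ≡ ∑[ x ∈ xs ] 𝟙 (i ≡ᵇ x)
mult-∑ i [] = refl
mult-∑ i (x ∷ xs) = cong₂ _+_ (𝟙-if (i ≡ᵇ x)) (mult-∑ i xs)

mult-↭ : ∀ i {xs ys} → xs ↭ ys → mult i xs ≡ mult i ys
mult-↭ i {xs} {ys} xs↭ys = begin
  mult i xs                    ≡⟨ mult-∑ i xs ⟩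
  ∑[ x ∈ xs ] 𝟙 (i ≡ᵇ x)       ≡⟨ ∑-sum xs _ ⟩
  sum (map _ xs)               ≡⟨ sum-↭ (↭-map⁺ (λ x → 𝟙 (i ≡ᵇ x)) xs↭ys) ⟩
  sum (map _ ys)               ≡⟨ ∑-sum ys _ ⟨
  ∑[ y ∈ ys ] 𝟙 (i ≡ᵇ y)       ≡⟨ mult-∑ i ys ⟨
  mult i ys                    ∎

mult-++ : ∀ i xs ys → mult i (xs ++ ys) ≡ mult i xs + mult i ys
mult-++ i xs ys = trans (mult-∑ i (xs ++ ys))
  (trans (∑-++ xs ys (λ x → 𝟙 (i ≡ᵇ x))) (sym (cong₂ _+_ (mult-∑ i xs) (mult-∑ i ys))))

partFact-↭ : ∀ {xs ys} → xs ↭ ys → partFact xs ≡ partFact ys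
partFact-↭ xs↭ys = product-↭ (↭-map⁺ _! xs↭ys)

partFact-++ : ∀ xs ys → partFact (xs ++ ys) ≡ partFact xs * partFact ys
partFact-++ xs ys = trans (cong product (map-++ _! xs ys)) (product-++ (map _! xs) (map _! ys))

mult-head : ∀ x xs → 0 < mult x (x ∷ xs)
mult-head x xs rewrite ≡ᵇ-refl x = s≤s z≤n

mult-absent : ∀ {i} xs → All (_< i) xs → mult i xs ≡ 0
mult-absent [] [] = refl
mult-absent {i} (x ∷ xs) (x<i ∷ xs<i) rewrite ≡ᵇ-false (>⇒≢ x<i) = mult-absent xs xs<i

sorted-below : ∀ {z zs w} → Linked _≥_ (z ∷ zs) → z < w → All (_< w) (z ∷ zs)
sorted-below {z} zs↘ z<w = All.map (λ u≤z → ≤-<-trans u≤z z<w) (Linked⇒All (λ p q → ≤-trans q p) (≤-refl {z}) zs↘)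

sorted-tail-≤ : ∀ {z zs} → Linked _≥_ (z ∷ zs) → All (_≤ z) zs
sorted-tail-≤ zs↘ with Linked⇒All (λ p q → ≤-trans q p) ≤-refl zs↘
... | _ ∷ zs≤z = zs≤z

sorted-unique : ∀ {xs ys} → Linked _≥_ xs → Linked _≥_ ys → (∀ i → mult i xs ≡ mult i ys) → xs ≡ ys
sorted-unique {[]} {[]} _ _ _ = refl
sorted-unique {[]} {y ∷ ys} _ _ same = contradiction (same y) (<⇒≢ (mult-head y ys))
sorted-unique {x ∷ xs} {[]} _ _ same = contradiction (sym (same x)) (<⇒≢ (mult-head x xs))
sorted-unique {x ∷ xs} {y ∷ ys} xs↘ ys↘ same with <-cmp x y
... | tri< x<y _ _ = contradiction (trans (sym (same y)) (mult-absent (x ∷ xs) (sorted-below xs↘ x<y))) (>⇒≢ (mult-head y ys))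
... | tri> _ _ y<x = contradiction (trans (same x) (mult-absent (y ∷ ys) (sorted-below ys↘ y<x))) (>⇒≢ (mult-head x xs))
... | tri≈ _ refl _ = cong (x ∷_) (sorted-unique (Linked.tail xs↘) (Linked.tail ys↘)
                                     (λ i → +-cancelˡ-≡ (if i ≡ᵇ x then 1 else 0) _ _ (same i)))

IsUnion : List ℕ → List ℕ → List ℕ → Set
IsUnion μ ν λ′ = ∀ i → mult i μ + mult i ν ≡ mult i λ′

allᵇ-complete : ∀ p xs → (∀ i → p i ≡ true) → allᵇ p xs ≡ true
allᵇ-complete p [] _ = refl
allᵇ-complete p (x ∷ xs) p≡true rewrite p≡true x = allᵇ-complete p xs p≡true

allᵇ-sound : ∀ p xs {i} → allᵇ p xs ≡ true → 0 < mult i xs → p i ≡ true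
allᵇ-sound p (x ∷ xs) {i} all 0<mult with ∧-split {p x} all | i ≡ᵇ x | ≡ᵇ-reflects i x
... | px , _ | true | ofʸ refl = px
... | _ , pxs | false | _ = allᵇ-sound p xs pxs 0<mult

multUnion-reflects : ∀ μ ν λ′ → Reflects (IsUnion μ ν λ′) (multUnion μ ν λ′)
multUnion-reflects μ ν λ′ with multUnion μ ν λ′ in union
... | true = ofʸ counts
  where
  counts : IsUnion μ ν λ′
  counts i with mult i (μ ++ ν ++ λ′) in occurrences
  ... | suc _ = ≡ᵇ⇒≡ _ _ (subst T (sym (allᵇ-sound _ (μ ++ ν ++ λ′) union (subst (0 <_) (sym occurrences) (s≤s z≤n)))) _)
  ... | zero = trans (cong₂ _+_ μ₀ ν₀) (sym λ₀)
    where
    total : mult i μ + (mult i ν + mult i λ′) ≡ 0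
    total = trans (sym (trans (mult-++ i μ (ν ++ λ′)) (cong (mult i μ +_) (mult-++ i ν λ′)))) occurrences
    μ₀ = m+n≡0⇒m≡0 (mult i μ) total
    ν₀ = m+n≡0⇒m≡0 (mult i ν) (m+n≡0⇒n≡0 (mult i μ) total)
    λ₀ = m+n≡0⇒n≡0 (mult i ν) (m+n≡0⇒n≡0 (mult i μ) total)
... | false = ofⁿ λ counts → contradiction
  (trans (sym (allᵇ-complete _ (μ ++ ν ++ λ′) λ i → ≡ᵇ-refl′ (counts i))) union) λ ()
  where
  ≡ᵇ-refl′ : ∀ {m n} → m ≡ n → (m ≡ᵇ n) ≡ true
  ≡ᵇ-refl′ = reflects-true (≡ᵇ-reflects _ _)

blockSizes : List ℕ → List ℕ
blockSizes A = map (λ j → countOf j A) (upTo (numBlocks A))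

mult-blockType : ∀ i C → isRGS C ≡ true → mult i (blockType C) ≡ ∑[ j ∈ upTo (blocksFrom 0 C) ] 𝟙 (i ≡ᵇ countOf j C)
mult-blockType i C ok = begin
  mult i (sortDesc (blockSizes C))                         ≡⟨ mult-↭ i (sortDesc-↭ (blockSizes C)) ⟩
  mult i (blockSizes C)                                    ≡⟨ mult-∑ i (blockSizes C) ⟩
  ∑ (blockSizes C) (λ x → 𝟙 (i ≡ᵇ x))                      ≡⟨ ∑-map (λ j → countOf j C) (upTo (numBlocks C)) (λ x → 𝟙 (i ≡ᵇ x)) ⟩
  ∑[ j ∈ upTo (numBlocks C) ] 𝟙 (i ≡ᵇ countOf j C)         ≡⟨ cong (λ k → ∑[ j ∈ upTo k ] 𝟙 (i ≡ᵇ countOf j C)) (numBlocks-isRGS C ok) ⟩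
  ∑[ j ∈ upTo (blocksFrom 0 C) ] 𝟙 (i ≡ᵇ countOf j C)      ∎

∑-upTo-split : ∀ P k (h₁ h₂ : ℕ → ℕ) →
  ∑[ j ∈ upTo k ] (if P j then h₁ (rank P j) else h₂ (rank (not ∘ P) j))
  ≡ ∑ (upTo (rank P k)) h₁ + ∑ (upTo (rank (not ∘ P) k)) h₂
∑-upTo-split P zero h₁ h₂ = refl
∑-upTo-split P (suc k) h₁ h₂ =
  trans (∑-upTo-suc k h) (trans (cong (_+ h k) (∑-upTo-split P k h₁ h₂)) last)
  where
  h : ℕ → ℕ
  h j = if P j then h₁ (rank P j) else h₂ (rank (not ∘ P) j)
  last : ∑ (upTo (rank P k)) h₁ + ∑ (upTo (rank (not ∘ P) k)) h₂ + h k
       ≡ ∑ (upTo (rank P (suc k))) h₁ + ∑ (upTo (rank (not ∘ P) (suc k))) h₂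
  last with P k
  ... | true rewrite ∑-upTo-suc (rank P k) h₁ =
    +-comm-right (∑ (upTo (rank P k)) h₁) (∑ (upTo (rank (not ∘ P) k)) h₂) (h₁ (rank P k))
  ... | false rewrite ∑-upTo-suc (rank (not ∘ P) k) h₂ =
    +-assoc (∑ (upTo (rank P k)) h₁) (∑ (upTo (rank (not ∘ P) k)) h₂) (h₂ (rank (not ∘ P) k))

blockType-restrict : ∀ C S → isRGS C ≡ true → IsUnion (blockType (restrict S C)) (blockType (restrictᶜ S C)) (blockType C)
blockType-restrict C S ok i = sym (begin
  mult i (blockType C)
    ≡⟨ mult-blockType i C ok ⟩
  ∑[ j ∈ upTo (blocksFrom 0 C) ] 𝟙 (i ≡ᵇ countOf j C)
    ≡⟨ ∑-cong (upTo (blocksFrom 0 C)) by-side ⟩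
  ∑[ j ∈ upTo (blocksFrom 0 C) ] (if P j then h X (rank P j) else h Y (rank (not ∘ P) j))
    ≡⟨ ∑-upTo-split P (blocksFrom 0 C) (h X) (h Y) ⟩
  ∑ (upTo (rank P (blocksFrom 0 C))) (h X) + ∑ (upTo (rank (not ∘ P) (blocksFrom 0 C))) (h Y)
    ≡⟨ cong₂ _+_ (mult-restricted P) (mult-restricted (not ∘ P)) ⟨
  mult i (blockType X) + mult i (blockType Y) ∎)
  where
  P = member S
  X = restrict S C
  Y = restrictᶜ S C
  h : List ℕ → ℕ → ℕ
  h D r = 𝟙 (i ≡ᵇ countOf r D)
  by-side : ∀ j → 𝟙 (i ≡ᵇ countOf j C) ≡ (if P j then h X (rank P j) else h Y (rank (not ∘ P) j))
  by-side j with P j in Pj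
  ... | true = cong (λ c → 𝟙 (i ≡ᵇ c)) (sym (countOf-stdBy P C Pj))
  ... | false = cong (λ c → 𝟙 (i ≡ᵇ c)) (sym (countOf-stdBy (not ∘ P) C (cong not Pj)))
  mult-restricted : ∀ Q → mult i (blockType (stdBy Q C)) ≡ ∑ (upTo (rank Q (blocksFrom 0 C))) (h (stdBy Q C))
  mult-restricted Q = trans (mult-blockType i (stdBy Q C) (proj₁ (stdBy-isRGSFrom Q 0 C ok)))
    (cong (λ k → ∑ (upTo k) (h (stdBy Q C))) (proj₂ (stdBy-isRGSFrom Q 0 C ok)))

blockType-≡-IsUnion : ∀ C S λ′ → isRGS C ≡ true → Linked _≥_ λ′ →
  eqList (blockType C) λ′ ≡ multUnion (blockType (restrict S C)) (blockType (restrictᶜ S C)) λ′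
blockType-≡-IsUnion C S λ′ ok λ′↘ = reflects-iff (eqList-reflects (blockType C) λ′)
  (multUnion-reflects (blockType (restrict S C)) (blockType (restrictᶜ S C)) λ′)
  (λ { refl → blockType-restrict C S ok })
  (λ union → sorted-unique (sortDesc-sorted (blockSizes C)) λ′↘ λ i → trans (sym (blockType-restrict C S ok i)) (union i))

∑-countOf : ∀ k A → All (_< k) A → ∑[ j ∈ upTo k ] countOf j A ≡ length A
∑-countOf k [] [] = ∑-zero (upTo k) (λ _ → refl)
∑-countOf k (x ∷ A) (x<k ∷ A<k) = begin
  ∑[ j ∈ upTo k ] ((if j ≡ᵇ x then 1 else 0) + countOf j A)
    ≡⟨ ∑-+ (upTo k) (λ j → if j ≡ᵇ x then 1 else 0) (λ j → countOf j A) ⟩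
  (∑[ j ∈ upTo k ] (if j ≡ᵇ x then 1 else 0)) + (∑[ j ∈ upTo k ] countOf j A)
    ≡⟨ cong₂ _+_ (trans (∑-cong (upTo k) (λ j → 𝟙-if (j ≡ᵇ x))) (trans (∑-upTo-≡ᵇ k x) (cong 𝟙 (<ᵇ-true x<k))))
                 (∑-countOf k A A<k) ⟩
  suc (length A) ∎

sum-blockType : ∀ A → isRGS A ≡ true → sum (blockType A) ≡ length A
sum-blockType A ok = begin
  sum (sortDesc (blockSizes A))                 ≡⟨ sum-↭ (sortDesc-↭ (blockSizes A)) ⟩
  sum (blockSizes A)                            ≡⟨ ∑-sum (upTo (numBlocks A)) (λ j → countOf j A) ⟨
  ∑[ j ∈ upTo (numBlocks A) ] countOf j A       ≡⟨ cong (λ k → ∑[ j ∈ upTo k ] countOf j A) (numBlocks-isRGS A ok) ⟩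
  ∑[ j ∈ upTo (blocksFrom 0 A) ] countOf j A    ≡⟨ ∑-countOf (blocksFrom 0 A) A (entries<blocks 0 A ok) ⟩
  length A                                      ∎

blockType-isPartition : ∀ A → isRGS A ≡ true → IsPartition (blockType A)
blockType-isPartition A ok = sortDesc-sorted (blockSizes A) , All-resp-↭ (↭-sym (sortDesc-↭ (blockSizes A)))
  (map⁺ (applyUpTo⁺₁ id (numBlocks A) λ j<nb → countOf-pos 0 A ok z≤n (subst (_ <_) (numBlocks-isRGS A ok) j<nb)))

-- Splittings and shuffles

∑-subsets-suc : ∀ k (g : List Bool → ℕ) → ∑ (subsets (suc k)) g ≡ ∑[ S ∈ subsets k ] (g (S ∷ʳ true) + g (S ∷ʳ false))
∑-subsets-suc zero g = trans (cong (g (true ∷ []) +_) (+-identityʳ (g (false ∷ [])))) (sym (+-identityʳ _))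
∑-subsets-suc (suc k) g = begin
  ∑ (subsets (suc (suc k))) g
    ≡⟨ by-head (suc k) g ⟩
  ∑ (subsets (suc k)) (g ∘ (true ∷_)) + ∑ (subsets (suc k)) (g ∘ (false ∷_))
    ≡⟨ cong₂ _+_ (∑-subsets-suc k (g ∘ (true ∷_))) (∑-subsets-suc k (g ∘ (false ∷_))) ⟩
  (∑[ S ∈ subsets k ] (g (true ∷ S ∷ʳ true) + g (true ∷ S ∷ʳ false)))
    + (∑[ S ∈ subsets k ] (g (false ∷ S ∷ʳ true) + g (false ∷ S ∷ʳ false)))
    ≡⟨ by-head k (λ S → g (S ∷ʳ true) + g (S ∷ʳ false)) ⟨
  ∑[ S ∈ subsets (suc k) ] (g (S ∷ʳ true) + g (S ∷ʳ false)) ∎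
  where
  by-head : ∀ k (h : List Bool → ℕ) → ∑ (subsets (suc k)) h ≡ ∑ (subsets k) (h ∘ (true ∷_)) + ∑ (subsets k) (h ∘ (false ∷_))
  by-head k h = begin
    ∑ (map (true ∷_) (subsets k) ++ map (false ∷_) (subsets k) ++ []) h
      ≡⟨ ∑-++ (map (true ∷_) (subsets k)) _ h ⟩
    ∑ (map (true ∷_) (subsets k)) h + ∑ (map (false ∷_) (subsets k) ++ []) h
      ≡⟨ cong₂ _+_ (∑-map (true ∷_) (subsets k) h) (trans (∑-++ (map (false ∷_) (subsets k)) [] h)
                                                        (trans (+-identityʳ _) (∑-map (false ∷_) (subsets k) h))) ⟩
    ∑ (subsets k) (h ∘ (true ∷_)) + ∑ (subsets k) (h ∘ (false ∷_)) ∎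

cut : List Bool → List ℕ → List ℕ × List ℕ
cut S C = restrict S C , restrictᶜ S C

splittings : List ℕ → List ℕ × List ℕ → ℕ
splittings C AB = ∑[ S ∈ subsets (blocksFrom 0 C) ] 𝟙 (eqPair (cut S C) AB)

overSplits : ℕ → (List ℕ × List ℕ → ℕ) → ℕ
overSplits n f = ∑[ C ∈ setPartitions n ] ∑[ S ∈ subsets (blocksFrom 0 C) ] f (cut S C)

splitCount : ℕ → List ℕ × List ℕ → ℕ
splitCount n AB = overSplits n (λ XY → 𝟙 (eqPair XY AB))

module _ (n : ℕ) where

  overSplits-cong : ∀ {f g} → (∀ XY → f XY ≡ g XY) → overSplits n f ≡ overSplits n g
  overSplits-cong f≗g = ∑-cong (setPartitions n) λ C → ∑-cong (subsets (blocksFrom 0 C)) λ S → f≗g (cut S C)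

  overSplits-+ : ∀ f g → overSplits n (λ XY → f XY + g XY) ≡ overSplits n f + overSplits n g
  overSplits-+ f g = trans (∑-cong (setPartitions n) λ C → ∑-+ (subsets (blocksFrom 0 C)) _ _)
                           (∑-+ (setPartitions n) _ _)

  overSplits-*ˡ : ∀ c f → overSplits n (λ XY → c * f XY) ≡ c * overSplits n f
  overSplits-*ˡ c f = trans (∑-cong (setPartitions n) λ C → ∑-*ˡ c (subsets (blocksFrom 0 C)) _)
                            (∑-*ˡ c (setPartitions n) _)

  overSplits-zero : ∀ {f} → (∀ XY → f XY ≡ 0) → overSplits n f ≡ 0
  overSplits-zero f≡0 = ∑-zero (setPartitions n) λ C → ∑-zero (subsets (blocksFrom 0 C)) λ S → f≡0 (cut S C)

cut-∷ʳ : ∀ S C j → cut S (C ∷ʳ j) ≡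
  (if member S j then (restrict S C ∷ʳ rank (member S) j , restrictᶜ S C)
                 else (restrict S C , restrictᶜ S C ∷ʳ rank (not ∘ member S) j))
cut-∷ʳ S C j rewrite stdBy-∷ʳ (member S) C j | stdBy-∷ʳ (not ∘ member S) C j with member S j
... | true = cong (restrict S C ∷ʳ _ ,_) (++-identityʳ (restrictᶜ S C))
... | false = cong (_, restrictᶜ S C ∷ʳ _) (++-identityʳ (restrict S C))

cut-∷ʳ-new : ∀ S b C {k} → length S ≡ k → All (_< k) C → cut (S ∷ʳ b) (C ∷ʳ k) ≡
  (if b then (restrict S C ∷ʳ rank (member S) k , restrictᶜ S C)
        else (restrict S C , restrictᶜ S C ∷ʳ rank (not ∘ member S) k))
cut-∷ʳ-new S b C refl C<k
  rewrite cut-∷ʳ (S ∷ʳ b) C (length S) | member-∷ʳ-length S b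
        | stdBy-cong {member (S ∷ʳ b)} {member S} (λ _ → member-∷ʳ-< S b) C<k
        | stdBy-cong {not ∘ member (S ∷ʳ b)} {not ∘ member S} (λ _ → cong not ∘ member-∷ʳ-< S b) C<k
        | rank-cong {member (S ∷ʳ b)} {member S} (λ _ → member-∷ʳ-< S b) (≤-refl {length S})
        | rank-cong {not ∘ member (S ∷ʳ b)} {not ∘ member S} (λ _ → cong not ∘ member-∷ʳ-< S b) (≤-refl {length S})
  = refl

appendˡ appendʳ : List ℕ × List ℕ → List ℕ × List ℕ → ℕ
appendˡ (X , Y) AB = ∑[ r ∈ upTo (suc (blocksFrom 0 X)) ] 𝟙 (eqPair (X ∷ʳ r , Y) AB)
appendʳ (X , Y) AB = ∑[ r ∈ upTo (suc (blocksFrom 0 Y)) ] 𝟙 (eqPair (X , Y ∷ʳ r) AB)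

-- The new last entry j either joins an old block (j < k), which S already places on one side, or opens
-- block k, which S ∷ʳ true or S ∷ʳ false places on either side: in every case one half gains one entry.
∑-splittings-extend : ∀ C AB S → isRGS C ≡ true → length S ≡ blocksFrom 0 C →
  (∑[ j ∈ upTo (blocksFrom 0 C) ] 𝟙 (eqPair (cut S (C ∷ʳ j)) AB))
    + (𝟙 (eqPair (cut (S ∷ʳ true) (C ∷ʳ blocksFrom 0 C)) AB) + 𝟙 (eqPair (cut (S ∷ʳ false) (C ∷ʳ blocksFrom 0 C)) AB))
  ≡ appendˡ (cut S C) AB + appendʳ (cut S C) AB
∑-splittings-extend C AB S ok |S| = begin
  (∑[ j ∈ upTo k ] 𝟙eq (cut S (C ∷ʳ j))) + (𝟙eq (cut (S ∷ʳ true) (C ∷ʳ k)) + 𝟙eq (cut (S ∷ʳ false) (C ∷ʳ k)))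
    ≡⟨ cong₂ _+_ (trans (∑-cong (upTo k) by-side) (∑-upTo-split P k h₁ h₂))
                 (cong₂ _+_ (cong 𝟙eq (cut-∷ʳ-new S true C |S| C<k)) (cong 𝟙eq (cut-∷ʳ-new S false C |S| C<k))) ⟩
  (∑ (upTo (rank P k)) h₁ + ∑ (upTo (rank (not ∘ P) k)) h₂) + (h₁ (rank P k) + h₂ (rank (not ∘ P) k))
    ≡⟨ +-interchange (∑ (upTo (rank P k)) h₁) _ _ _ ⟩
  (∑ (upTo (rank P k)) h₁ + h₁ (rank P k)) + (∑ (upTo (rank (not ∘ P) k)) h₂ + h₂ (rank (not ∘ P) k))
    ≡⟨ cong₂ _+_ (∑-upTo-suc (rank P k) h₁) (∑-upTo-suc (rank (not ∘ P) k) h₂) ⟨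
  ∑ (upTo (suc (rank P k))) h₁ + ∑ (upTo (suc (rank (not ∘ P) k))) h₂
    ≡⟨ cong₂ (λ a b → ∑ (upTo (suc a)) h₁ + ∑ (upTo (suc b)) h₂) (blocks-std P) (blocks-std (not ∘ P)) ⟨
  appendˡ (cut S C) AB + appendʳ (cut S C) AB ∎
  where
  k = blocksFrom 0 C
  P = member S
  C<k = entries<blocks 0 C ok
  𝟙eq : List ℕ × List ℕ → ℕ
  𝟙eq XY = 𝟙 (eqPair XY AB)
  h₁ h₂ : ℕ → ℕ
  h₁ r = 𝟙eq (restrict S C ∷ʳ r , restrictᶜ S C)
  h₂ r = 𝟙eq (restrict S C , restrictᶜ S C ∷ʳ r)
  by-side : ∀ j → 𝟙eq (cut S (C ∷ʳ j)) ≡ (if P j then h₁ (rank P j) else h₂ (rank (not ∘ P) j))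
  by-side j = trans (cong 𝟙eq (cut-∷ʳ S C j)) (if-float 𝟙eq (P j))
  blocks-std : ∀ Q → blocksFrom 0 (stdBy Q C) ≡ rank Q k
  blocks-std Q = proj₂ (stdBy-isRGSFrom Q 0 C ok)

splittings-∷ʳ : ∀ C AB → isRGS C ≡ true →
  ∑[ j ∈ upTo (suc (blocksFrom 0 C)) ] splittings (C ∷ʳ j) AB
  ≡ ∑[ S ∈ subsets (blocksFrom 0 C) ] (appendˡ (cut S C) AB + appendʳ (cut S C) AB)
splittings-∷ʳ C AB ok = begin
  ∑[ j ∈ upTo (suc k) ] splittings (C ∷ʳ j) AB
    ≡⟨ ∑-upTo-suc k (λ j → splittings (C ∷ʳ j) AB) ⟩
  (∑[ j ∈ upTo k ] splittings (C ∷ʳ j) AB) + splittings (C ∷ʳ k) AB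
    ≡⟨ cong₂ _+_ (∑-congᴬ (applyUpTo⁺₁ id k id) old-block) (cong (λ b → ∑ (subsets b) (g k)) (trans (blocksFrom-∷ʳ 0 C k) (afterEntry-new k))) ⟩
  (∑[ j ∈ upTo k ] ∑[ S ∈ subsets k ] g j S) + ∑ (subsets (suc k)) (g k)
    ≡⟨ cong₂ _+_ (∑-swap (upTo k) (subsets k) g) (∑-subsets-suc k (g k)) ⟩
  (∑[ S ∈ subsets k ] ∑[ j ∈ upTo k ] g j S) + (∑[ S ∈ subsets k ] (g k (S ∷ʳ true) + g k (S ∷ʳ false)))
    ≡⟨ ∑-+ (subsets k) _ _ ⟨
  ∑[ S ∈ subsets k ] ((∑[ j ∈ upTo k ] g j S) + (g k (S ∷ʳ true) + g k (S ∷ʳ false)))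
    ≡⟨ ∑-congᴬ (subsets-length k) (λ S → ∑-splittings-extend C AB S ok) ⟩
  ∑[ S ∈ subsets k ] (appendˡ (cut S C) AB + appendʳ (cut S C) AB) ∎
  where
  k = blocksFrom 0 C
  g : ℕ → List Bool → ℕ
  g j S = 𝟙 (eqPair (cut S (C ∷ʳ j)) AB)
  old-block : ∀ j → j < k → splittings (C ∷ʳ j) AB ≡ ∑ (subsets k) (g j)
  old-block j j<k = cong (λ b → ∑ (subsets b) (g j)) (trans (blocksFrom-∷ʳ 0 C j) (afterEntry-old j<k))

splitCount-suc : ∀ n AB → splitCount (suc n) AB ≡ overSplits n (λ XY → appendˡ XY AB) + overSplits n (λ XY → appendʳ XY AB)
splitCount-suc n AB = begin
  ∑[ C ∈ setPartitions (suc n) ] splittings C AB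
    ≡⟨ ∑-setPartitions-suc n (λ C → splittings C AB) ⟩
  ∑[ C ∈ setPartitions n ] ∑[ j ∈ upTo (suc (blocksFrom 0 C)) ] splittings (C ∷ʳ j) AB
    ≡⟨ ∑-congᴬ (setPartitions-isRGS n) (λ C → splittings-∷ʳ C AB) ⟩
  overSplits n (λ XY → appendˡ XY AB + appendʳ XY AB)
    ≡⟨ overSplits-+ n (λ XY → appendˡ XY AB) (λ XY → appendʳ XY AB) ⟩
  overSplits n (λ XY → appendˡ XY AB) + overSplits n (λ XY → appendʳ XY AB) ∎

appendˡ-[] : ∀ XY B → appendˡ XY ([] , B) ≡ 0
appendˡ-[] (X , Y) B = ∑-zero (upTo (suc (blocksFrom 0 X))) λ r → cong (λ b → 𝟙 (b ∧ eqList Y B)) (eqList-∷ʳ-[] X r)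

appendʳ-[] : ∀ XY A → appendʳ XY (A , []) ≡ 0
appendʳ-[] (X , Y) A = ∑-zero (upTo (suc (blocksFrom 0 Y))) λ r →
  trans (cong (λ b → 𝟙 (eqList X A ∧ b)) (eqList-∷ʳ-[] Y r)) (cong 𝟙 (∧-zeroʳ (eqList X A)))

appendˡ-∷ʳ : ∀ XY A a B → appendˡ XY (A ∷ʳ a , B) ≡ 𝟙 (a ≤ᵇ blocksFrom 0 A) * 𝟙 (eqPair XY (A , B))
appendˡ-∷ʳ (X , Y) A a B = trans
  (∑-cong (upTo (suc (blocksFrom 0 X))) λ r → begin
    𝟙 (eqList (X ∷ʳ r) (A ∷ʳ a) ∧ eqList Y B)      ≡⟨ cong (λ b → 𝟙 (b ∧ eqList Y B)) (eqList-∷ʳ X A r a) ⟩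
    𝟙 ((eqList X A ∧ (r ≡ᵇ a)) ∧ eqList Y B)      ≡⟨ cong 𝟙 (∧-∧-swap (eqList X A) (r ≡ᵇ a) (eqList Y B)) ⟩
    𝟙 ((eqList X A ∧ eqList Y B) ∧ (r ≡ᵇ a))      ≡⟨ 𝟙-∧ (eqList X A ∧ eqList Y B) (r ≡ᵇ a) ⟩
    𝟙 (eqList X A ∧ eqList Y B) * 𝟙 (r ≡ᵇ a)      ∎)
  (∑-upTo-pinned eqPair-reflects (X , Y) (A , B) (blocksFrom 0 ∘ proj₁) a)

appendʳ-∷ʳ : ∀ XY A B b → appendʳ XY (A , B ∷ʳ b) ≡ 𝟙 (b ≤ᵇ blocksFrom 0 B) * 𝟙 (eqPair XY (A , B))
appendʳ-∷ʳ (X , Y) A B b = trans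
  (∑-cong (upTo (suc (blocksFrom 0 Y))) λ r → begin
    𝟙 (eqList X A ∧ eqList (Y ∷ʳ r) (B ∷ʳ b))      ≡⟨ cong (λ c → 𝟙 (eqList X A ∧ c)) (eqList-∷ʳ Y B r b) ⟩
    𝟙 (eqList X A ∧ (eqList Y B ∧ (r ≡ᵇ b)))      ≡⟨ cong 𝟙 (∧-assoc (eqList X A) (eqList Y B) (r ≡ᵇ b)) ⟨
    𝟙 ((eqList X A ∧ eqList Y B) ∧ (r ≡ᵇ b))      ≡⟨ 𝟙-∧ (eqList X A ∧ eqList Y B) (r ≡ᵇ b) ⟩
    𝟙 (eqList X A ∧ eqList Y B) * 𝟙 (r ≡ᵇ b)      ∎)
  (∑-upTo-pinned eqPair-reflects (X , Y) (A , B) (blocksFrom 0 ∘ proj₂) b)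

overSplits-appendˡ-[] : ∀ n B → overSplits n (λ XY → appendˡ XY ([] , B)) ≡ 0
overSplits-appendˡ-[] n B = overSplits-zero n λ XY → appendˡ-[] XY B

overSplits-appendʳ-[] : ∀ n A → overSplits n (λ XY → appendʳ XY (A , [])) ≡ 0
overSplits-appendʳ-[] n A = overSplits-zero n λ XY → appendʳ-[] XY A

overSplits-appendˡ : ∀ n A a B → overSplits n (λ XY → appendˡ XY (A ∷ʳ a , B)) ≡ 𝟙 (a ≤ᵇ blocksFrom 0 A) * splitCount n (A , B)
overSplits-appendˡ n A a B = trans (overSplits-cong n λ XY → appendˡ-∷ʳ XY A a B)
  (overSplits-*ˡ n (𝟙 (a ≤ᵇ blocksFrom 0 A)) (λ XY → 𝟙 (eqPair XY (A , B))))

overSplits-appendʳ : ∀ n A B b → overSplits n (λ XY → appendʳ XY (A , B ∷ʳ b)) ≡ 𝟙 (b ≤ᵇ blocksFrom 0 B) * splitCount n (A , B)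
overSplits-appendʳ n A B b = trans (overSplits-cong n λ XY → appendʳ-∷ʳ XY A B b)
  (overSplits-*ˡ n (𝟙 (b ≤ᵇ blocksFrom 0 B)) (λ XY → 𝟙 (eqPair XY (A , B))))

shuffles : ℕ → ℕ → ℕ → ℕ
shuffles n a b = 𝟙 (a + b ≡ᵇ n) * (n choose a)

shuffles-pascal : ∀ n a b → shuffles (suc n) (suc a) (suc b) ≡ shuffles n a (suc b) + shuffles n (suc a) b
shuffles-pascal n a b rewrite +-suc a b =
  trans (cong (𝟙 (suc (a + b) ≡ᵇ n) *_) (sym (nCk+nC[k+1]≡[n+1]C[k+1] n a)))
        (*-distribˡ-+ (𝟙 (suc (a + b) ≡ᵇ n)) (n choose a) (n choose suc a))

shuffles-suc-right : ∀ n a → shuffles (suc n) (suc a) 0 ≡ shuffles n a 0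
shuffles-suc-right n a rewrite +-identityʳ a with a ≡ᵇ n | ≡ᵇ-reflects a n
... | true | ofʸ refl rewrite nCn≡1 (suc a) | nCn≡1 a = refl
... | false | _ = refl

shuffleFormula : ℕ → List ℕ × List ℕ → ℕ
shuffleFormula n (A , B) = 𝟙 (isRGS A) * 𝟙 (isRGS B) * shuffles n (length A) (length B)

shuffleFormula-[]-∷ʳ : ∀ n B b →
  𝟙 (b ≤ᵇ blocksFrom 0 B) * shuffleFormula n ([] , B) ≡ shuffleFormula (suc n) ([] , B ∷ʳ b)
shuffleFormula-[]-∷ʳ n B b
  rewrite isRGS-∷ʳ B b | length-∷ʳ B b | 𝟙-∧ (isRGS B) (b ≤ᵇ blocksFrom 0 B) =
  rearrange (𝟙 (b ≤ᵇ blocksFrom 0 B)) (𝟙 (isRGS B)) (shuffles n 0 (length B))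
  where
  rearrange : ∀ s r x → s * (1 * r * x) ≡ 1 * (r * s) * x
  rearrange = solve-∀

shuffleFormula-∷ʳ-[] : ∀ n A a →
  𝟙 (a ≤ᵇ blocksFrom 0 A) * shuffleFormula n (A , []) ≡ shuffleFormula (suc n) (A ∷ʳ a , [])
shuffleFormula-∷ʳ-[] n A a
  rewrite isRGS-∷ʳ A a | length-∷ʳ A a | 𝟙-∧ (isRGS A) (a ≤ᵇ blocksFrom 0 A) | shuffles-suc-right n (length A) =
  rearrange (𝟙 (a ≤ᵇ blocksFrom 0 A)) (𝟙 (isRGS A)) (shuffles n (length A) 0)
  where
  rearrange : ∀ p q x → p * (q * 1 * x) ≡ q * p * 1 * x
  rearrange = solve-∀

shuffleFormula-∷ʳ-∷ʳ : ∀ n A a B b →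
  𝟙 (a ≤ᵇ blocksFrom 0 A) * shuffleFormula n (A , B ∷ʳ b) + 𝟙 (b ≤ᵇ blocksFrom 0 B) * shuffleFormula n (A ∷ʳ a , B)
  ≡ shuffleFormula (suc n) (A ∷ʳ a , B ∷ʳ b)
shuffleFormula-∷ʳ-∷ʳ n A a B b
  rewrite isRGS-∷ʳ A a | isRGS-∷ʳ B b | length-∷ʳ A a | length-∷ʳ B b
        | 𝟙-∧ (isRGS A) (a ≤ᵇ blocksFrom 0 A) | 𝟙-∧ (isRGS B) (b ≤ᵇ blocksFrom 0 B)
        | shuffles-pascal n (length A) (length B) =
  rearrange (𝟙 (a ≤ᵇ blocksFrom 0 A)) (𝟙 (isRGS A)) (𝟙 (isRGS B)) (𝟙 (b ≤ᵇ blocksFrom 0 B))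
            (shuffles n (length A) (suc (length B))) (shuffles n (suc (length A)) (length B))
  where
  rearrange : ∀ p q r s x y → p * (q * (r * s) * x) + s * (q * p * r * y) ≡ q * p * (r * s) * (x + y)
  rearrange = solve-∀

splitCount≡shuffleFormula : ∀ n AB → splitCount n AB ≡ shuffleFormula n AB
splitCount≡shuffleFormula zero ([] , []) = refl
splitCount≡shuffleFormula zero ([] , B@(_ ∷ _)) = sym (*-zeroʳ (1 * 𝟙 (isRGS B)))
splitCount≡shuffleFormula zero (A@(_ ∷ _) , B) = sym (*-zeroʳ (𝟙 (isRGS A) * 𝟙 (isRGS B)))
splitCount≡shuffleFormula (suc n) (A , B) with initLast A | initLast B
... | [] | [] =
  trans (splitCount-suc n ([] , [])) (cong₂ _+_ (overSplits-appendˡ-[] n []) (overSplits-appendʳ-[] n []))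
... | [] | B₀ ∷ʳ′ b = begin
  splitCount (suc n) ([] , B₀ ∷ʳ b)
    ≡⟨ splitCount-suc n ([] , B₀ ∷ʳ b) ⟩
  overSplits n (λ XY → appendˡ XY ([] , B₀ ∷ʳ b)) + overSplits n (λ XY → appendʳ XY ([] , B₀ ∷ʳ b))
    ≡⟨ cong₂ _+_ (overSplits-appendˡ-[] n (B₀ ∷ʳ b)) (overSplits-appendʳ n [] B₀ b) ⟩
  𝟙 (b ≤ᵇ blocksFrom 0 B₀) * splitCount n ([] , B₀)
    ≡⟨ cong (𝟙 (b ≤ᵇ blocksFrom 0 B₀) *_) (splitCount≡shuffleFormula n ([] , B₀)) ⟩
  𝟙 (b ≤ᵇ blocksFrom 0 B₀) * shuffleFormula n ([] , B₀)
    ≡⟨ shuffleFormula-[]-∷ʳ n B₀ b ⟩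
  shuffleFormula (suc n) ([] , B₀ ∷ʳ b) ∎
... | A₀ ∷ʳ′ a | [] = begin
  splitCount (suc n) (A₀ ∷ʳ a , [])
    ≡⟨ splitCount-suc n (A₀ ∷ʳ a , []) ⟩
  overSplits n (λ XY → appendˡ XY (A₀ ∷ʳ a , [])) + overSplits n (λ XY → appendʳ XY (A₀ ∷ʳ a , []))
    ≡⟨ cong₂ _+_ (overSplits-appendˡ n A₀ a []) (overSplits-appendʳ-[] n (A₀ ∷ʳ a)) ⟩
  𝟙 (a ≤ᵇ blocksFrom 0 A₀) * splitCount n (A₀ , []) + 0
    ≡⟨ +-identityʳ _ ⟩
  𝟙 (a ≤ᵇ blocksFrom 0 A₀) * splitCount n (A₀ , [])
    ≡⟨ cong (𝟙 (a ≤ᵇ blocksFrom 0 A₀) *_) (splitCount≡shuffleFormula n (A₀ , [])) ⟩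
  𝟙 (a ≤ᵇ blocksFrom 0 A₀) * shuffleFormula n (A₀ , [])
    ≡⟨ shuffleFormula-∷ʳ-[] n A₀ a ⟩
  shuffleFormula (suc n) (A₀ ∷ʳ a , []) ∎
... | A₀ ∷ʳ′ a | B₀ ∷ʳ′ b = begin
  splitCount (suc n) (A₀ ∷ʳ a , B₀ ∷ʳ b)
    ≡⟨ splitCount-suc n (A₀ ∷ʳ a , B₀ ∷ʳ b) ⟩
  overSplits n (λ XY → appendˡ XY (A₀ ∷ʳ a , B₀ ∷ʳ b)) + overSplits n (λ XY → appendʳ XY (A₀ ∷ʳ a , B₀ ∷ʳ b))
    ≡⟨ cong₂ _+_ (overSplits-appendˡ n A₀ a (B₀ ∷ʳ b)) (overSplits-appendʳ n (A₀ ∷ʳ a) B₀ b) ⟩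
  𝟙 (a ≤ᵇ blocksFrom 0 A₀) * splitCount n (A₀ , B₀ ∷ʳ b) + 𝟙 (b ≤ᵇ blocksFrom 0 B₀) * splitCount n (A₀ ∷ʳ a , B₀)
    ≡⟨ cong₂ (λ x y → 𝟙 (a ≤ᵇ blocksFrom 0 A₀) * x + 𝟙 (b ≤ᵇ blocksFrom 0 B₀) * y)
             (splitCount≡shuffleFormula n (A₀ , B₀ ∷ʳ b)) (splitCount≡shuffleFormula n (A₀ ∷ʳ a , B₀)) ⟩
  𝟙 (a ≤ᵇ blocksFrom 0 A₀) * shuffleFormula n (A₀ , B₀ ∷ʳ b) + 𝟙 (b ≤ᵇ blocksFrom 0 B₀) * shuffleFormula n (A₀ ∷ʳ a , B₀)
    ≡⟨ shuffleFormula-∷ʳ-∷ʳ n A₀ a B₀ b ⟩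
  shuffleFormula (suc n) (A₀ ∷ʳ a , B₀ ∷ʳ b) ∎

partsBounded-sum : ∀ f n k → All (λ μ → sum μ ≡ n) (partsBounded f n k)
partsBounded-sum f zero k = refl ∷ []
partsBounded-sum zero (suc n) k = []
partsBounded-sum (suc f) (suc n) k =
  concat⁺ (map⁺ {f = λ p → map (p ∷_) (partsBounded f (suc n ∸ p) p)}
    (filter⁺ (T? ∘ (_≤ᵇ k)) (map⁺ {f = suc} (applyUpTo⁺₁ id (suc n) with-first))))
  where
  with-first : ∀ {q} → q < suc n → All (λ μ → sum μ ≡ suc n) (map (suc q ∷_) (partsBounded f (suc n ∸ suc q) (suc q)))
  with-first {q} q<1+n = map⁺ (All.map (λ sum≡ → trans (cong (suc q +_) sum≡) (m+[n∸m]≡n q<1+n))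
                                       (partsBounded-sum f (suc n ∸ suc q) (suc q)))

∑-partsBounded-≡ : ∀ f n k ν → IsPartition ν → sum ν ≡ n → n ≤ f → All (_≤ k) ν →
  ∑[ μ ∈ partsBounded f n k ] 𝟙 (eqList μ ν) ≡ 1
∑-partsBounded-≡ f zero k [] _ _ _ _ = refl
∑-partsBounded-≡ f zero k (x ∷ ν) (_ , 0<x ∷ _) sum≡0 _ _ = contradiction sum≡0 (>⇒≢ (<-≤-trans 0<x (m≤m+n x (sum ν))))
∑-partsBounded-≡ (suc f) (suc n) k (suc x ∷ ν) (ν↘ , _ ∷ ν>0) sum≡ (s≤s n≤f) (x<k ∷ _) = begin
  ∑ (concatMap (λ p → map (p ∷_) (partsBounded f (suc n ∸ p) p)) parts) (λ μ → 𝟙 (eqList μ (suc x ∷ ν)))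
    ≡⟨ ∑-concatMap (λ p → map (p ∷_) (partsBounded f (suc n ∸ p) p)) parts _ ⟩
  ∑[ p ∈ parts ] ∑ (map (p ∷_) (partsBounded f (suc n ∸ p) p)) (λ μ → 𝟙 (eqList μ (suc x ∷ ν)))
    ≡⟨ ∑-cong parts (λ p → trans (∑-map (p ∷_) (partsBounded f (suc n ∸ p) p) _)
                             (trans (∑-cong (partsBounded f (suc n ∸ p) p) λ μ → 𝟙-∧ (p ≡ᵇ suc x) (eqList μ ν))
                                    (∑-*ˡ (𝟙 (p ≡ᵇ suc x)) (partsBounded f (suc n ∸ p) p) _))) ⟩
  ∑[ p ∈ parts ] 𝟙 (p ≡ᵇ suc x) * (∑[ μ ∈ partsBounded f (suc n ∸ p) p ] 𝟙 (eqList μ ν))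
    ≡⟨ ∑-𝟙-subst ≡ᵇ-reflects parts (suc x) (λ p → ∑[ μ ∈ partsBounded f (suc n ∸ p) p ] 𝟙 (eqList μ ν)) ⟩
  (∑[ p ∈ parts ] 𝟙 (p ≡ᵇ suc x)) * (∑[ μ ∈ partsBounded f (suc n ∸ suc x) (suc x) ] 𝟙 (eqList μ ν))
    ≡⟨ cong₂ _*_ x∈parts-once tail-once ⟩
  1 ∎
  where
  parts = filterᵇ (_≤ᵇ k) (map suc (upTo (suc n)))
  x≤n : x ≤ n
  x≤n = s≤s⁻¹ (subst (suc x ≤_) sum≡ (m≤m+n (suc x) (sum ν)))
  tail-once : ∑[ μ ∈ partsBounded f (suc n ∸ suc x) (suc x) ] 𝟙 (eqList μ ν) ≡ 1
  tail-once = ∑-partsBounded-≡ f (n ∸ x) (suc x) ν (Linked.tail ν↘ , ν>0)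
    (+-cancelˡ-≡ (suc x) (sum ν) (n ∸ x) (trans sum≡ (cong suc (sym (m+[n∸m]≡n x≤n)))))
    (≤-trans (m∸n≤m n x) n≤f) (sorted-tail-≤ ν↘)
  x∈parts-once : ∑[ p ∈ parts ] 𝟙 (p ≡ᵇ suc x) ≡ 1
  x∈parts-once = begin
    ∑[ p ∈ parts ] 𝟙 (p ≡ᵇ suc x)
      ≡⟨ ∑-filter (_≤ᵇ k) (map suc (upTo (suc n))) _ ⟩
    ∑[ p ∈ map suc (upTo (suc n)) ] 𝟙 (p ≤ᵇ k) * 𝟙 (p ≡ᵇ suc x)
      ≡⟨ ∑-cong (map suc (upTo (suc n))) (λ p → *-comm (𝟙 (p ≤ᵇ k)) _) ⟩
    ∑[ p ∈ map suc (upTo (suc n)) ] 𝟙 (p ≡ᵇ suc x) * 𝟙 (p ≤ᵇ k)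
      ≡⟨ ∑-𝟙-subst ≡ᵇ-reflects (map suc (upTo (suc n))) (suc x) (λ p → 𝟙 (p ≤ᵇ k)) ⟩
    (∑[ p ∈ map suc (upTo (suc n)) ] 𝟙 (p ≡ᵇ suc x)) * 𝟙 (suc x ≤ᵇ k)
      ≡⟨ cong₂ _*_ (trans (∑-map suc (upTo (suc n)) (λ p → 𝟙 (p ≡ᵇ suc x))) (∑-upTo-≡ᵇ (suc n) x)) (cong 𝟙 (reflects-true (≤ᵇ-reflects-≤ _ k) x<k)) ⟩
    𝟙 (x <ᵇ suc n) * 1
      ≡⟨ cong (λ b → 𝟙 b * 1) (<ᵇ-true (s≤s x≤n)) ⟩
    1 ∎

∑-partitionsOf-≡ : ∀ k ν → IsPartition ν → ∑[ μ ∈ partitionsOf k ] 𝟙 (eqList μ ν) ≡ 𝟙 (k ≡ᵇ sum ν)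
∑-partitionsOf-≡ k ν ν-part with k ≡ᵇ sum ν | ≡ᵇ-reflects k (sum ν)
... | true | ofʸ refl = ∑-partsBounded-≡ k k k ν ν-part refl ≤-refl (parts≤sum ν)
  where
  parts≤sum : ∀ ν → All (_≤ sum ν) ν
  parts≤sum [] = []
  parts≤sum (x ∷ ν) = m≤m+n x (sum ν) ∷ All.map (λ y≤ → ≤-trans y≤ (m≤n+m (sum ν) x)) (parts≤sum ν)
... | false | ofⁿ k≢sum = trans
  (∑-congᴬ {h = λ _ → 0} (partsBounded-sum k k k) λ μ sum≡k →
    cong 𝟙 (reflects-false (eqList-reflects μ ν) λ { refl → k≢sum (sym sum≡k) }))
  (∑-zero (partitionsOf k) λ _ → refl)

-- Rational coefficients

ι : ℕ → ℚ
ι n = ℤ.+ n ℚ./ 1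

private
  toℚᵘ-/ : ∀ i n .{{_ : NonZero n}} → toℚᵘ (i ℚ./ n) ≃ᵘ (i /ᵘ n)
  toℚᵘ-/ i (suc d) = toℚᵘ-fromℚᵘ (mkℚᵘ i d)

ι-+ : ∀ m n → ι (m + n) ≡ ι m ℚ.+ ι n
ι-+ m n = toℚᵘ-injective (ℚᵘ.≃-trans (toℚᵘ-/ (ℤ.+ (m + n)) 1) (ℚᵘ.≃-trans (*≡* num)
  (ℚᵘ.≃-sym (ℚᵘ.≃-trans (toℚᵘ-homo-+ (ι m) (ι n)) (ℚᵘ.+-cong (toℚᵘ-/ (ℤ.+ m) 1) (toℚᵘ-/ (ℤ.+ n) 1))))))
  where
  num : ℤ.+ (m + n) ℤ.* ℤ.+ 1 ≡ (ℤ.+ m ℤ.* ℤ.+ 1 ℤ.+ ℤ.+ n ℤ.* ℤ.+ 1) ℤ.* ℤ.+ 1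
  num rewrite ℤ.*-identityʳ (ℤ.+ (m + n)) | ℤ.*-identityʳ (ℤ.+ m) | ℤ.*-identityʳ (ℤ.+ n) | ℤ.*-identityʳ (ℤ.+ m ℤ.+ ℤ.+ n) =
    ℤ.pos-+ m n

ι-* : ∀ m n → ι (m * n) ≡ ι m ℚ.* ι n
ι-* m n = toℚᵘ-injective (ℚᵘ.≃-trans (toℚᵘ-/ (ℤ.+ (m * n)) 1) (ℚᵘ.≃-trans (*≡* num)
  (ℚᵘ.≃-sym (ℚᵘ.≃-trans (toℚᵘ-homo-* (ι m) (ι n)) (ℚᵘ.*-cong (toℚᵘ-/ (ℤ.+ m) 1) (toℚᵘ-/ (ℤ.+ n) 1))))))
  where
  num : ℤ.+ (m * n) ℤ.* ℤ.+ 1 ≡ (ℤ.+ m ℤ.* ℤ.+ n) ℤ.* ℤ.+ 1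
  num rewrite ℤ.*-identityʳ (ℤ.+ (m * n)) | ℤ.*-identityʳ (ℤ.+ m ℤ.* ℤ.+ n) = ℤ.pos-* m n

1/n*ι-n : ∀ n .{{_ : NonZero n}} → (ℤ.+ 1 ℚ./ n) ℚ.* ι n ≡ 1ℚ
1/n*ι-n (suc d) = toℚᵘ-injective (ℚᵘ.≃-trans (toℚᵘ-homo-* (ℤ.+ 1 ℚ./ suc d) (ι (suc d)))
  (ℚᵘ.≃-trans (ℚᵘ.*-cong (toℚᵘ-/ (ℤ.+ 1) (suc d)) (toℚᵘ-/ (ℤ.+ suc d) 1)) (*≡* num)))
  where
  num : (ℤ.+ 1 ℤ.* ℤ.+ suc d) ℤ.* ℤ.+ 1 ≡ ℤ.+ 1 ℤ.* ℤ.+ (suc d * 1)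
  num rewrite *-identityʳ d | *-identityʳ (d + 0) = refl

inv! : ℕ → ℚ
inv! n = (ℤ.+ 1 ℚ./ n !) {{n !≢0}}

factorialRatio : ℕ → ℕ → ℚ
factorialRatio p n = ι p ℚ.* inv! n

binomial-factorials : ∀ a b → ((a + b) choose a) * a ! * b ! ≡ (a + b) !
binomial-factorials a b = begin
  ((a + b) choose a) * a ! * b !                            ≡⟨ *-assoc ((a + b) choose a) (a !) (b !) ⟩
  ((a + b) choose a) * (a ! * b !)                          ≡⟨ cong (λ m → ((a + b) choose a) * (a ! * m !)) (m+n∸m≡n a b) ⟨
  ((a + b) choose a) * (a ! * (a + b ∸ a) !)                ≡⟨ cong (_* (a ! * (a + b ∸ a) !)) (nCk≡n!/k![n-k]! (m≤m+n a b)) ⟩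
  ((a + b) ! / (a ! * (a + b ∸ a) !)) {{nz}} * (a ! * (a + b ∸ a) !) ≡⟨ m/n*n≡m {{nz}} (k![n∸k]!∣n! (m≤m+n a b)) ⟩
  (a + b) !                                                 ∎
  where
  nz : NonZero (a ! * (a + b ∸ a) !)
  nz = m*n≢0 (a !) ((a + b ∸ a) !) {{a !≢0}} {{(a + b ∸ a) !≢0}}

inv!-binomial : ∀ a b → inv! (a + b) ℚ.* ι ((a + b) choose a) ≡ inv! a ℚ.* inv! b
inv!-binomial a b = begin
  w ℚ.* ι c
    ≡⟨ ℚ.*-identityʳ _ ⟨
  w ℚ.* ι c ℚ.* 1ℚ
    ≡⟨ cong (w ℚ.* ι c ℚ.*_) (sym (cong₂ ℚ._*_ (1/n*ι-n (a !) {{a !≢0}}) (1/n*ι-n (b !) {{b !≢0}}))) ⟩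
  w ℚ.* ι c ℚ.* ((u ℚ.* ι (a !)) ℚ.* (v ℚ.* ι (b !)))
    ≡⟨ rearrange w (ι c) u (ι (a !)) v (ι (b !)) ⟩
  (u ℚ.* v) ℚ.* (w ℚ.* (ι c ℚ.* ι (a !) ℚ.* ι (b !)))
    ≡⟨ cong (λ x → (u ℚ.* v) ℚ.* (w ℚ.* x)) (trans (cong (ℚ._* ι (b !)) (sym (ι-* c (a !)))) (sym (ι-* (c * a !) (b !)))) ⟩
  (u ℚ.* v) ℚ.* (w ℚ.* ι (c * a ! * b !))
    ≡⟨ cong (λ m → (u ℚ.* v) ℚ.* (w ℚ.* ι m)) (binomial-factorials a b) ⟩
  (u ℚ.* v) ℚ.* (w ℚ.* ι ((a + b) !))
    ≡⟨ cong ((u ℚ.* v) ℚ.*_) (1/n*ι-n ((a + b) !) {{(a + b) !≢0}}) ⟩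
  (u ℚ.* v) ℚ.* 1ℚ
    ≡⟨ ℚ.*-identityʳ (u ℚ.* v) ⟩
  u ℚ.* v ∎
  where
  w = inv! (a + b)
  u = inv! a
  v = inv! b
  c = (a + b) choose a
  rearrange : ∀ w c u a v b → w ℚ.* c ℚ.* ((u ℚ.* a) ℚ.* (v ℚ.* b)) ≡ (u ℚ.* v) ℚ.* (w ℚ.* (c ℚ.* a ℚ.* b))
  rearrange = solve 6 (λ w c u a v b → w :* c :* ((u :* a) :* (v :* b)) := (u :* v) :* (w :* (c :* a :* b))) refl
    where open +-*-Solver

factorialRatio-binomial : ∀ p q a b →
  factorialRatio (p * q) (a + b) ℚ.* ι ((a + b) choose a) ≡ factorialRatio p a ℚ.* factorialRatio q b
factorialRatio-binomial p q a b = begin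
  ι (p * q) ℚ.* inv! (a + b) ℚ.* ι ((a + b) choose a)     ≡⟨ cong (λ x → x ℚ.* inv! (a + b) ℚ.* ι ((a + b) choose a)) (ι-* p q) ⟩
  ι p ℚ.* ι q ℚ.* inv! (a + b) ℚ.* ι ((a + b) choose a)   ≡⟨ ℚ.*-assoc (ι p ℚ.* ι q) (inv! (a + b)) _ ⟩
  ι p ℚ.* ι q ℚ.* (inv! (a + b) ℚ.* ι ((a + b) choose a)) ≡⟨ cong (ι p ℚ.* ι q ℚ.*_) (inv!-binomial a b) ⟩
  ι p ℚ.* ι q ℚ.* (inv! a ℚ.* inv! b)                     ≡⟨ interchange (ι p) (ι q) (inv! a) (inv! b) ⟩
  ι p ℚ.* inv! a ℚ.* (ι q ℚ.* inv! b)                     ∎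
  where
  interchange : ∀ x y z t → x ℚ.* y ℚ.* (z ℚ.* t) ≡ x ℚ.* z ℚ.* (y ℚ.* t)
  interchange = solve 4 (λ x y z t → x :* y :* (z :* t) := x :* z :* (y :* t)) refl
    where open +-*-Solver

sorted-union : ∀ {λ′ μ ν} → Linked _≥_ λ′ → IsUnion μ ν λ′ → λ′ ≡ sortDesc (μ ++ ν)
sorted-union {λ′} {μ} {ν} λ′↘ union = sorted-unique λ′↘ (sortDesc-sorted (μ ++ ν)) λ i →
  trans (sym (union i)) (sym (trans (mult-↭ i (sortDesc-↭ (μ ++ ν))) (mult-++ i μ ν)))

χCoeff-union : ∀ λ′ μ ν → Linked _≥_ λ′ → IsUnion μ ν λ′ →
  χCoeff λ′ ℚ.* ι (sum λ′ choose sum μ) ≡ χCoeff μ ℚ.* χCoeff ν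
χCoeff-union λ′ μ ν λ′↘ union = begin
  χCoeff λ′ ℚ.* ι (sum λ′ choose sum μ)
    ≡⟨ cong (λ l → χCoeff l ℚ.* ι (sum l choose sum μ)) (sorted-union {λ′} {μ} {ν} λ′↘ union) ⟩
  factorialRatio (partFact (sortDesc (μ ++ ν))) (sum (sortDesc (μ ++ ν))) ℚ.* ι (sum (sortDesc (μ ++ ν)) choose sum μ)
    ≡⟨ cong₂ (λ p s → factorialRatio p s ℚ.* ι (s choose sum μ)) partFact-sorted sum-sorted ⟩
  factorialRatio (partFact μ * partFact ν) (sum μ + sum ν) ℚ.* ι ((sum μ + sum ν) choose sum μ)
    ≡⟨ factorialRatio-binomial (partFact μ) (partFact ν) (sum μ) (sum ν) ⟩
  factorialRatio (partFact μ) (sum μ) ℚ.* factorialRatio (partFact ν) (sum ν) ∎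
  where
  partFact-sorted : partFact (sortDesc (μ ++ ν)) ≡ partFact μ * partFact ν
  partFact-sorted = trans (partFact-↭ (sortDesc-↭ (μ ++ ν))) (partFact-++ μ ν)
  sum-sorted : sum (sortDesc (μ ++ ν)) ≡ sum μ + sum ν
  sum-sorted = trans (sum-↭ (sortDesc-↭ (μ ++ ν))) (sum-++ μ ν)

∑ℚ : List E → (E → ℚ) → ℚ
∑ℚ [] φ = 0ℚ
∑ℚ (x ∷ xs) φ = φ x ℚ.+ ∑ℚ xs φ

infix 5 ∑ℚ
syntax ∑ℚ xs (λ x → φ) = ∑ℚ[ x ∈ xs ] φ

∑ℚ-map : ∀ (f : F → E) ys φ → ∑ℚ (map f ys) φ ≡ ∑ℚ ys (φ ∘ f)
∑ℚ-map f [] φ = refl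
∑ℚ-map f (y ∷ ys) φ = cong (φ (f y) ℚ.+_) (∑ℚ-map f ys φ)

∑ℚ-congᴬ : ∀ {P : E → Set} {xs φ ψ} → All P xs → (∀ x → P x → φ x ≡ ψ x) → ∑ℚ xs φ ≡ ∑ℚ xs ψ
∑ℚ-congᴬ [] _ = refl
∑ℚ-congᴬ {xs = x ∷ _} (px ∷ pxs) φ≗ψ = cong₂ ℚ._+_ (φ≗ψ x px) (∑ℚ-congᴬ pxs φ≗ψ)

∑ℚ-cong : ∀ (xs : List E) {φ ψ} → (∀ x → φ x ≡ ψ x) → ∑ℚ xs φ ≡ ∑ℚ xs ψ
∑ℚ-cong xs φ≗ψ = ∑ℚ-congᴬ (All.universal (λ _ → tt) xs) (λ x _ → φ≗ψ x)

∑ℚ-*ι : ∀ (xs : List E) K g → ∑ℚ[ x ∈ xs ] K ℚ.* ι (g x) ≡ K ℚ.* ι (∑ xs g)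
∑ℚ-*ι [] K g = sym (ℚ.*-zeroʳ K)
∑ℚ-*ι (x ∷ xs) K g = begin
  K ℚ.* ι (g x) ℚ.+ (∑ℚ[ y ∈ xs ] K ℚ.* ι (g y)) ≡⟨ cong (K ℚ.* ι (g x) ℚ.+_) (∑ℚ-*ι xs K g) ⟩
  K ℚ.* ι (g x) ℚ.+ K ℚ.* ι (∑ xs g)          ≡⟨ ℚ.*-distribˡ-+ K (ι (g x)) (ι (∑ xs g)) ⟨
  K ℚ.* (ι (g x) ℚ.+ ι (∑ xs g))              ≡⟨ cong (K ℚ.*_) (ι-+ (g x) (∑ xs g)) ⟨
  K ℚ.* ι (g x + ∑ xs g)                      ∎

∑ℚ-ι : ∀ (xs : List E) g → ∑ℚ[ x ∈ xs ] ι (g x) ≡ ι (∑ xs g)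
∑ℚ-ι [] g = refl
∑ℚ-ι (x ∷ xs) g = trans (cong (ι (g x) ℚ.+_) (∑ℚ-ι xs g)) (sym (ι-+ (g x) (∑ xs g)))

pair : Comb E → (E → ℚ) → ℚ
pair [] φ = 0ℚ
pair ((c , x) ∷ F) φ = c ℚ.* φ x ℚ.+ pair F φ

coeff-pair : ∀ eq (F : Comb E) b → coeff eq F b ≡ pair F (λ x → if eq x b then 1ℚ else 0ℚ)
coeff-pair eq [] b = refl
coeff-pair eq ((c , x) ∷ F) b = cong₂ ℚ._+_ (scaled (eq x b)) (coeff-pair eq F b)
  where
  scaled : ∀ e → (if e then c else 0ℚ) ≡ c ℚ.* (if e then 1ℚ else 0ℚ)
  scaled true = sym (ℚ.*-identityʳ c)
  scaled false = sym (ℚ.*-zeroʳ c)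

pair-++ : ∀ (F G : Comb E) φ → pair (F ++ G) φ ≡ pair F φ ℚ.+ pair G φ
pair-++ [] G φ = sym (ℚ.+-identityˡ _)
pair-++ ((c , x) ∷ F) G φ = trans (cong (c ℚ.* φ x ℚ.+_) (pair-++ F G φ)) (sym (ℚ.+-assoc (c ℚ.* φ x) _ _))

pair-scale : ∀ c (F : Comb E) φ → pair (scale c F) φ ≡ c ℚ.* pair F φ
pair-scale c [] φ = sym (ℚ.*-zeroʳ c)
pair-scale c ((d , x) ∷ F) φ =
  trans (cong₂ ℚ._+_ (ℚ.*-assoc c d (φ x)) (pair-scale c F φ)) (sym (ℚ.*-distribˡ-+ c (d ℚ.* φ x) _))

pair-linExt : ∀ (g : F → Comb E) (F′ : Comb F) φ → pair (linExt g F′) φ ≡ pair F′ (λ x → pair (g x) φ)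
pair-linExt g [] φ = refl
pair-linExt g ((c , x) ∷ F′) φ =
  trans (pair-++ (scale c (g x)) (linExt g F′) φ) (cong₂ ℚ._+_ (pair-scale c (g x) φ) (pair-linExt g F′ φ))

pair-congᴬ : ∀ {P : E → Set} {F : Comb E} {φ ψ} → All (P ∘ proj₂) F → (∀ x → P x → φ x ≡ ψ x) → pair F φ ≡ pair F ψ
pair-congᴬ [] _ = refl
pair-congᴬ {F = (c , x) ∷ _} (px ∷ pxs) φ≗ψ = cong₂ ℚ._+_ (cong (c ℚ.*_) (φ≗ψ x px)) (pair-congᴬ pxs φ≗ψ)

pair-map : ∀ c (h : F → E) ys φ → pair (map (λ y → (c , h y)) ys) φ ≡ c ℚ.* ∑ℚ ys (φ ∘ h)
pair-map c h [] φ = sym (ℚ.*-zeroʳ c)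
pair-map c h (y ∷ ys) φ = trans (cong (c ℚ.* φ (h y) ℚ.+_) (pair-map c h ys φ)) (sym (ℚ.*-distribˡ-+ c _ _))

pair-concatMap : ∀ (f : F → Comb E) ys φ → pair (concatMap f ys) φ ≡ ∑ℚ[ y ∈ ys ] pair (f y) φ
pair-concatMap f [] φ = refl
pair-concatMap f (y ∷ ys) φ = trans (pair-++ (f y) (concatMap f ys) φ) (cong (pair (f y) φ ℚ.+_) (pair-concatMap f ys φ))

pair-cong : ∀ (F : Comb E) {φ ψ} → (∀ x → φ x ≡ ψ x) → pair F φ ≡ pair F ψ
pair-cong F φ≗ψ = pair-congᴬ (All.universal (λ _ → tt) F) (λ x _ → φ≗ψ x)

*-ι-congˡ : ∀ (c K : ℚ) m → (0 < m → c ≡ K) → c ℚ.* ι m ≡ K ℚ.* ι m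
*-ι-congˡ c K zero _ = trans (ℚ.*-zeroʳ c) (sym (ℚ.*-zeroʳ K))
*-ι-congˡ c K (suc m) c≡K = cong (ℚ._* ι (suc m)) (c≡K (s≤s z≤n))

*-ι-𝟙 : ∀ (c K : ℚ) b m → (b ≡ true → c ℚ.* ι m ≡ K) → c ℚ.* ι (𝟙 b * m) ≡ K ℚ.* ι (𝟙 b)
*-ι-𝟙 c K true m scaled = trans (cong (λ k → c ℚ.* ι k) (+-identityʳ m)) (trans (scaled refl) (sym (ℚ.*-identityʳ K)))
*-ι-𝟙 c K false m _ = trans (ℚ.*-zeroʳ c) (sym (ℚ.*-zeroʳ K))

-- Both sides on a basis element

indicator : List ℕ × List ℕ → List ℕ × List ℕ → ℚ
indicator AB XY = ι (𝟙 (eqPair XY AB))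

coeff-indicator : ∀ (F : Comb (List ℕ × List ℕ)) AB → coeff eqPair F AB ≡ pair F (indicator AB)
coeff-indicator F AB = trans (coeff-pair eqPair F AB) (pair-cong F λ XY → as-ι (eqPair XY AB))
  where
  as-ι : ∀ b → (if b then 1ℚ else 0ℚ) ≡ ι (𝟙 b)
  as-ι true = refl
  as-ι false = refl

χSupport : List ℕ → List (List ℕ)
χSupport λ′ = filterᵇ (λ C → eqList (blockType C) λ′) (setPartitions (sum λ′))

χSupport-isRGS : ∀ λ′ → All (λ C → isRGS C ≡ true) (χSupport λ′)
χSupport-isRGS λ′ = filter⁺ (T? ∘ λ C → eqList (blockType C) λ′) (setPartitions-isRGS (sum λ′))

pair-ΔNCSymBasis : ∀ C AB → isRGS C ≡ true → pair (ΔNCSymBasis C) (indicator AB) ≡ ι (splittings C AB)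
pair-ΔNCSymBasis C AB ok = begin
  pair (ΔNCSymBasis C) (indicator AB)
    ≡⟨ pair-map 1ℚ standardizations (subsets (numBlocks C)) (indicator AB) ⟩
  1ℚ ℚ.* (∑ℚ[ S ∈ subsets (numBlocks C) ] ι (𝟙 (eqPair (standardizations S) AB)))
    ≡⟨ ℚ.*-identityˡ _ ⟩
  ∑ℚ[ S ∈ subsets (numBlocks C) ] ι (𝟙 (eqPair (standardizations S) AB))
    ≡⟨ ∑ℚ-ι (subsets (numBlocks C)) (λ S → 𝟙 (eqPair (standardizations S) AB)) ⟩
  ι (∑[ S ∈ subsets (numBlocks C) ] 𝟙 (eqPair (standardizations S) AB))
    ≡⟨ cong ι (subst (λ k → ∑[ S ∈ subsets k ] 𝟙 (eqPair (standardizations S) AB) ≡ splittings C AB)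
                     (sym (numBlocks-isRGS C ok)) (∑-congᴬ (subsets-length (blocksFrom 0 C)) standardizations≡cut)) ⟩
  ι (splittings C AB) ∎
  where
  standardizations : List Bool → List ℕ × List ℕ
  standardizations S = standardize C S , standardize C (map not S)
  standardizations≡cut : ∀ S → length S ≡ blocksFrom 0 C → 𝟙 (eqPair (standardizations S) AB) ≡ 𝟙 (eqPair (cut S C) AB)
  standardizations≡cut S |S| = cong (λ XY → 𝟙 (eqPair XY AB))
    (cong₂ _,_ (standardize-restrict C S ok) (standardize-restrictᶜ C S ok |S|))

∑-χSupport-splittings : ∀ λ′ A B → Linked _≥_ λ′ →
  ∑[ C ∈ χSupport λ′ ] splittings C (A , B) ≡ 𝟙 (multUnion (blockType A) (blockType B) λ′) * splitCount (sum λ′) (A , B)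
∑-χSupport-splittings λ′ A B λ′↘ = begin
  ∑[ C ∈ χSupport λ′ ] splittings C (A , B)
    ≡⟨ ∑-filter (λ C → eqList (blockType C) λ′) (setPartitions (sum λ′)) (λ C → splittings C (A , B)) ⟩
  ∑[ C ∈ setPartitions (sum λ′) ] 𝟙 (eqList (blockType C) λ′) * splittings C (A , B)
    ≡⟨ ∑-congᴬ (setPartitions-isRGS (sum λ′)) (λ C ok → trans
         (sym (∑-*ˡ (𝟙 (eqList (blockType C) λ′)) (subsets (blocksFrom 0 C)) _))
         (∑-cong (subsets (blocksFrom 0 C)) λ S → cong (λ b → 𝟙 b * _) (blockType-≡-IsUnion C S λ′ ok λ′↘))) ⟩
  overSplits (sum λ′) (λ XY → 𝟙 (unionOf XY) * 𝟙 (eqPair XY (A , B)))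
    ≡⟨ overSplits-cong (sum λ′) pinned ⟩
  overSplits (sum λ′) (λ XY → 𝟙 (unionOf (A , B)) * 𝟙 (eqPair XY (A , B)))
    ≡⟨ overSplits-*ˡ (sum λ′) (𝟙 (unionOf (A , B))) (λ XY → 𝟙 (eqPair XY (A , B))) ⟩
  𝟙 (unionOf (A , B)) * splitCount (sum λ′) (A , B) ∎
  where
  unionOf : List ℕ × List ℕ → Bool
  unionOf (X , Y) = multUnion (blockType X) (blockType Y) λ′
  pinned : ∀ XY → 𝟙 (unionOf XY) * 𝟙 (eqPair XY (A , B)) ≡ 𝟙 (unionOf (A , B)) * 𝟙 (eqPair XY (A , B))
  pinned XY = trans (*-comm (𝟙 (unionOf XY)) _)
    (trans (𝟙-subst (eqPair-reflects XY (A , B)) (𝟙 ∘ unionOf)) (*-comm _ (𝟙 (unionOf (A , B)))))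

occurrences : List ℕ → List ℕ → ℕ
occurrences A μ = ∑[ A′ ∈ χSupport μ ] 𝟙 (eqList A′ A)

occurrences-≡ : ∀ A μ → occurrences A μ ≡ 𝟙 (isRGS A ∧ eqList μ (blockType A))
occurrences-≡ A μ = begin
  ∑[ A′ ∈ χSupport μ ] 𝟙 (eqList A′ A)
    ≡⟨ ∑-filter (λ C → eqList (blockType C) μ) (setPartitions (sum μ)) (λ A′ → 𝟙 (eqList A′ A)) ⟩
  ∑[ C ∈ setPartitions (sum μ) ] 𝟙 (eqList (blockType C) μ) * 𝟙 (eqList C A)
    ≡⟨ ∑-cong (setPartitions (sum μ)) (λ C → *-comm (𝟙 (eqList (blockType C) μ)) _) ⟩
  ∑[ C ∈ setPartitions (sum μ) ] 𝟙 (eqList C A) * 𝟙 (eqList (blockType C) μ)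
    ≡⟨ ∑-𝟙-subst eqList-reflects (setPartitions (sum μ)) A (λ C → 𝟙 (eqList (blockType C) μ)) ⟩
  (∑[ C ∈ setPartitions (sum μ) ] 𝟙 (eqList C A)) * 𝟙 (eqList (blockType A) μ)
    ≡⟨ cong (_* 𝟙 (eqList (blockType A) μ)) (∑-setPartitions-≡ (sum μ) A) ⟩
  𝟙 (isRGS A ∧ (length A ≡ᵇ sum μ)) * 𝟙 (eqList (blockType A) μ)
    ≡⟨ 𝟙-∧ (isRGS A ∧ (length A ≡ᵇ sum μ)) (eqList (blockType A) μ) ⟨
  𝟙 ((isRGS A ∧ (length A ≡ᵇ sum μ)) ∧ eqList (blockType A) μ)
    ≡⟨ cong 𝟙 (reflects-iff ((T-reflects (isRGS A) ×-reflects ≡ᵇ-reflects (length A) (sum μ))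
                               ×-reflects eqList-reflects (blockType A) μ)
                            (T-reflects (isRGS A) ×-reflects eqList-reflects μ (blockType A))
                            (λ { ((rgs , _) , refl) → rgs , refl })
                            (λ { (rgs , refl) → (rgs , sym (sum-blockType A (≡-true rgs))) , refl })) ⟩
  𝟙 (isRGS A ∧ eqList μ (blockType A)) ∎
  where
  ≡-true : ∀ {b} → T b → b ≡ true
  ≡-true {true} _ = refl

pair-χ⊗χBasis : ∀ μ ν A B → pair (χ⊗χBasis (μ , ν)) (indicator (A , B))
  ≡ (χCoeff μ ℚ.* χCoeff ν) ℚ.* ι (occurrences A μ * occurrences B ν)
pair-χ⊗χBasis μ ν A B = begin
  pair (χ⊗χBasis (μ , ν)) (indicator (A , B))
    ≡⟨ pair-concatMap _ (χBasis μ) (indicator (A , B)) ⟩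
  ∑ℚ (χBasis μ) _
    ≡⟨ ∑ℚ-map (λ A′ → (χCoeff μ , A′)) (χSupport μ) _ ⟩
  ∑ℚ[ A′ ∈ χSupport μ ] pair (map _ (map (λ B′ → (χCoeff ν , B′)) (χSupport ν))) (indicator (A , B))
    ≡⟨ ∑ℚ-cong (χSupport μ) (λ A′ → begin
        pair (map _ (map (λ B′ → (χCoeff ν , B′)) (χSupport ν))) (indicator (A , B))
          ≡⟨ cong (λ F → pair F (indicator (A , B))) (map-∘ (χSupport ν)) ⟨
        pair (map (λ B′ → (K , (A′ , B′))) (χSupport ν)) (indicator (A , B))
          ≡⟨ pair-map K (A′ ,_) (χSupport ν) (indicator (A , B)) ⟩
        K ℚ.* (∑ℚ[ B′ ∈ χSupport ν ] ι (𝟙 (eqList A′ A ∧ eqList B′ B)))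
          ≡⟨ cong (K ℚ.*_) (∑ℚ-ι (χSupport ν) _) ⟩
        K ℚ.* ι (∑[ B′ ∈ χSupport ν ] 𝟙 (eqList A′ A ∧ eqList B′ B)) ∎) ⟩
  ∑ℚ[ A′ ∈ χSupport μ ] K ℚ.* ι (∑[ B′ ∈ χSupport ν ] 𝟙 (eqList A′ A ∧ eqList B′ B))
    ≡⟨ ∑ℚ-*ι (χSupport μ) K _ ⟩
  K ℚ.* ι (∑[ A′ ∈ χSupport μ ] ∑[ B′ ∈ χSupport ν ] 𝟙 (eqList A′ A ∧ eqList B′ B))
    ≡⟨ cong (λ m → K ℚ.* ι m) factorise ⟩
  K ℚ.* ι (occurrences A μ * occurrences B ν) ∎
  where
  K = χCoeff μ ℚ.* χCoeff ν
  factorise : ∑[ A′ ∈ χSupport μ ] ∑[ B′ ∈ χSupport ν ] 𝟙 (eqList A′ A ∧ eqList B′ B) ≡ occurrences A μ * occurrences B ν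
  factorise = trans (∑-cong (χSupport μ) λ A′ → trans (∑-cong (χSupport ν) λ B′ → 𝟙-∧ (eqList A′ A) (eqList B′ B))
                                                   (∑-*ˡ (𝟙 (eqList A′ A)) (χSupport ν) _))
                  (∑-*ʳ (occurrences B ν) (χSupport μ) _)

χCoeff-pinned : ∀ A B μ ν → 0 < occurrences A μ * occurrences B ν →
  χCoeff μ ℚ.* χCoeff ν ≡ χCoeff (blockType A) ℚ.* χCoeff (blockType B)
χCoeff-pinned A B μ ν pos
  with 𝟙-*-pos (isRGS A ∧ eqList μ (blockType A)) (isRGS B ∧ eqList ν (blockType B))
         (subst (0 <_) (cong₂ _*_ (occurrences-≡ A μ) (occurrences-≡ B ν)) pos)
... | okA , okB = cong₂ (λ μ′ ν′ → χCoeff μ′ ℚ.* χCoeff ν′)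
  (reflects-sound (eqList-reflects μ (blockType A)) (proj₂ (∧-split {isRGS A} okA)))
  (reflects-sound (eqList-reflects ν (blockType B)) (proj₂ (∧-split {isRGS B} okB)))

coproductCount : List ℕ → List ℕ → List ℕ → ℕ
coproductCount λ′ A B =
  ∑[ k ∈ upTo (suc (sum λ′)) ] ∑[ μ ∈ partitionsOf k ]
  ∑[ ν ∈ filterᵇ (λ ν → multUnion μ ν λ′) (partitionsOf (sum λ′ ∸ k)) ] occurrences A μ * occurrences B ν

pair-ΔSymBasis : ∀ λ′ A B → pair (ΔSymBasis λ′) (λ μν → pair (χ⊗χBasis μν) (indicator (A , B)))
  ≡ (χCoeff (blockType A) ℚ.* χCoeff (blockType B)) ℚ.* ι (coproductCount λ′ A B)
pair-ΔSymBasis λ′ A B =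
  trans (pair-concatMap (λ k → concatMap (λ μ → map (λ ν → (1ℚ , (μ , ν))) (νs k μ)) (partitionsOf k)) (upTo (suc n)) ψ)
  (trans (∑ℚ-cong (upTo (suc n)) λ k →
            trans (pair-concatMap (λ μ → map (λ ν → (1ℚ , (μ , ν))) (νs k μ)) (partitionsOf k) ψ)
            (trans (∑ℚ-cong (partitionsOf k) (inner k)) (∑ℚ-*ι (partitionsOf k) K (λ μ → ∑ (νs k μ) (g μ)))))
         (∑ℚ-*ι (upTo (suc n)) K λ k → ∑[ μ ∈ partitionsOf k ] ∑ (νs k μ) (g μ)))
  where
  n = sum λ′
  K = χCoeff (blockType A) ℚ.* χCoeff (blockType B)
  ψ : List ℕ × List ℕ → ℚ
  ψ μν = pair (χ⊗χBasis μν) (indicator (A , B))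
  νs : ℕ → List ℕ → List (List ℕ)
  νs k μ = filterᵇ (λ ν → multUnion μ ν λ′) (partitionsOf (n ∸ k))
  g : List ℕ → List ℕ → ℕ
  g μ ν = occurrences A μ * occurrences B ν
  inner : ∀ k μ → pair (map (λ ν → (1ℚ , (μ , ν))) (νs k μ)) ψ ≡ K ℚ.* ι (∑ (νs k μ) (g μ))
  inner k μ = begin
    pair (map (λ ν → (1ℚ , (μ , ν))) (νs k μ)) ψ        ≡⟨ pair-map 1ℚ (μ ,_) (νs k μ) ψ ⟩
    1ℚ ℚ.* (∑ℚ[ ν ∈ νs k μ ] ψ (μ , ν))                ≡⟨ ℚ.*-identityˡ _ ⟩
    ∑ℚ[ ν ∈ νs k μ ] ψ (μ , ν)                         ≡⟨ ∑ℚ-cong (νs k μ) (λ ν → trans (pair-χ⊗χBasis μ ν A B)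
                                                                  (*-ι-congˡ _ K (g μ ν) (χCoeff-pinned A B μ ν))) ⟩
    ∑ℚ[ ν ∈ νs k μ ] K ℚ.* ι (g μ ν)                   ≡⟨ ∑ℚ-*ι (νs k μ) K (g μ) ⟩
    K ℚ.* ι (∑ (νs k μ) (g μ))                         ∎

occurrences-rgs : ∀ A μ → isRGS A ≡ true → occurrences A μ ≡ 𝟙 (eqList μ (blockType A))
occurrences-rgs A μ ok = trans (occurrences-≡ A μ) (cong (λ r → 𝟙 (r ∧ eqList μ (blockType A))) ok)

∑-complements : ∀ λ′ A B μ m → isRGS A ≡ true → isRGS B ≡ true →
  ∑ (filterᵇ (λ ν → multUnion μ ν λ′) (partitionsOf m)) (λ ν → occurrences A μ * occurrences B ν)
  ≡ 𝟙 (multUnion (blockType A) (blockType B) λ′) * (𝟙 (eqList μ (blockType A)) * 𝟙 (m ≡ᵇ sum (blockType B)))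
∑-complements λ′ A B μ m okA okB = begin
  ∑ (filterᵇ (λ ν → multUnion μ ν λ′) (partitionsOf m)) (λ ν → occurrences A μ * occurrences B ν)
    ≡⟨ ∑-filter (λ ν → multUnion μ ν λ′) (partitionsOf m) _ ⟩
  ∑[ ν ∈ partitionsOf m ] 𝟙 (multUnion μ ν λ′) * (occurrences A μ * occurrences B ν)
    ≡⟨ ∑-cong (partitionsOf m) (λ ν → begin
        𝟙 (multUnion μ ν λ′) * (occurrences A μ * occurrences B ν)
          ≡⟨ cong₂ (λ a b → 𝟙 (multUnion μ ν λ′) * (a * b)) (occurrences-rgs A μ okA) (occurrences-rgs B ν okB) ⟩
        𝟙 (multUnion μ ν λ′) * (𝟙 (eqList μ bA) * 𝟙 (eqList ν bB))
          ≡⟨ 𝟙-subst₂ (eqList-reflects μ bA) (eqList-reflects ν bB) (λ μ′ ν′ → 𝟙 (multUnion μ′ ν′ λ′)) ⟩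
        𝟙 mu * (𝟙 (eqList μ bA) * 𝟙 (eqList ν bB)) ∎) ⟩
  ∑[ ν ∈ partitionsOf m ] 𝟙 mu * (𝟙 (eqList μ bA) * 𝟙 (eqList ν bB))
    ≡⟨ trans (∑-*ˡ (𝟙 mu) (partitionsOf m) _) (cong (𝟙 mu *_) (∑-*ˡ (𝟙 (eqList μ bA)) (partitionsOf m) _)) ⟩
  𝟙 mu * (𝟙 (eqList μ bA) * (∑[ ν ∈ partitionsOf m ] 𝟙 (eqList ν bB)))
    ≡⟨ cong (λ c → 𝟙 mu * (𝟙 (eqList μ bA) * c)) (∑-partitionsOf-≡ m bB (blockType-isPartition B okB)) ⟩
  𝟙 mu * (𝟙 (eqList μ bA) * 𝟙 (m ≡ᵇ sum bB)) ∎
  where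
  bA = blockType A
  bB = blockType B
  mu = multUnion bA bB λ′

coproductCount-rgs : ∀ λ′ A B → isRGS A ≡ true → isRGS B ≡ true →
  coproductCount λ′ A B ≡ 𝟙 (multUnion (blockType A) (blockType B) λ′) * 𝟙 (length A + length B ≡ᵇ sum λ′)
coproductCount-rgs λ′ A B okA okB = begin
  coproductCount λ′ A B
    ≡⟨ ∑-cong (upTo (suc n)) (λ k → trans (∑-cong (partitionsOf k) λ μ → ∑-complements λ′ A B μ (n ∸ k) okA okB)
                                          (first-factor k)) ⟩
  ∑[ k ∈ upTo (suc n) ] 𝟙 mu * (𝟙 (k ≡ᵇ sum bA) * 𝟙 (n ∸ k ≡ᵇ sum bB))
    ≡⟨ ∑-*ˡ (𝟙 mu) (upTo (suc n)) _ ⟩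
  𝟙 mu * (∑[ k ∈ upTo (suc n) ] 𝟙 (k ≡ᵇ sum bA) * 𝟙 (n ∸ k ≡ᵇ sum bB))
    ≡⟨ cong (𝟙 mu *_) (∑-𝟙-subst ≡ᵇ-reflects (upTo (suc n)) (sum bA) (λ k → 𝟙 (n ∸ k ≡ᵇ sum bB))) ⟩
  𝟙 mu * ((∑[ k ∈ upTo (suc n) ] 𝟙 (k ≡ᵇ sum bA)) * 𝟙 (n ∸ sum bA ≡ᵇ sum bB))
    ≡⟨ cong (λ m → 𝟙 mu * (m * 𝟙 (n ∸ sum bA ≡ᵇ sum bB))) (∑-upTo-≡ᵇ (suc n) (sum bA)) ⟩
  𝟙 mu * (𝟙 (sum bA <ᵇ suc n) * 𝟙 (n ∸ sum bA ≡ᵇ sum bB))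
    ≡⟨ cong (𝟙 mu *_) (<ᵇ-suc-∸ (sum bA) (sum bB) n) ⟩
  𝟙 mu * 𝟙 (sum bA + sum bB ≡ᵇ n)
    ≡⟨ cong₂ (λ a b → 𝟙 mu * 𝟙 (a + b ≡ᵇ n)) (sum-blockType A okA) (sum-blockType B okB) ⟩
  𝟙 mu * 𝟙 (length A + length B ≡ᵇ n) ∎
  where
  n = sum λ′
  bA = blockType A
  bB = blockType B
  mu = multUnion bA bB λ′
  first-factor : ∀ k → ∑[ μ ∈ partitionsOf k ] 𝟙 mu * (𝟙 (eqList μ bA) * 𝟙 (n ∸ k ≡ᵇ sum bB))
                     ≡ 𝟙 mu * (𝟙 (k ≡ᵇ sum bA) * 𝟙 (n ∸ k ≡ᵇ sum bB))
  first-factor k = begin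
    ∑[ μ ∈ partitionsOf k ] 𝟙 mu * (𝟙 (eqList μ bA) * c)
      ≡⟨ ∑-*ˡ (𝟙 mu) (partitionsOf k) _ ⟩
    𝟙 mu * (∑[ μ ∈ partitionsOf k ] 𝟙 (eqList μ bA) * c)
      ≡⟨ cong (𝟙 mu *_) (∑-*ʳ c (partitionsOf k) _) ⟩
    𝟙 mu * ((∑[ μ ∈ partitionsOf k ] 𝟙 (eqList μ bA)) * c)
      ≡⟨ cong (λ m → 𝟙 mu * (m * c)) (∑-partitionsOf-≡ k bA (blockType-isPartition A okA)) ⟩
    𝟙 mu * (𝟙 (k ≡ᵇ sum bA) * c) ∎
    where c = 𝟙 (n ∸ k ≡ᵇ sum bB)

coproductCount-non-rgs : ∀ λ′ A B → isRGS A ∧ isRGS B ≡ false → coproductCount λ′ A B ≡ 0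
coproductCount-non-rgs λ′ A B non-rgs =
  ∑-zero (upTo (suc (sum λ′))) λ k → ∑-zero (partitionsOf k) λ μ → ∑-zero (filterᵇ _ (partitionsOf (sum λ′ ∸ k))) λ ν →
    trans (cong₂ _*_ (occurrences-≡ A μ) (occurrences-≡ B ν)) (no-occurrence (isRGS A) (isRGS B) non-rgs)
  where
  no-occurrence : ∀ a b {x y} → a ∧ b ≡ false → 𝟙 (a ∧ x) * 𝟙 (b ∧ y) ≡ 0
  no-occurrence true false {x} _ = *-zeroʳ (𝟙 x)
  no-occurrence false b _ = refl

coproductCount-≡ : ∀ λ′ A B → coproductCount λ′ A B
  ≡ 𝟙 (isRGS A) * 𝟙 (isRGS B) * (𝟙 (multUnion (blockType A) (blockType B) λ′) * 𝟙 (length A + length B ≡ᵇ sum λ′))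
coproductCount-≡ λ′ A B with isRGS A in okA | isRGS B in okB
... | true | true = trans (coproductCount-rgs λ′ A B okA okB) (sym (+-identityʳ _))
... | true | false = coproductCount-non-rgs λ′ A B (cong₂ _∧_ okA okB)
... | false | _ = coproductCount-non-rgs λ′ A B (cong (_∧ isRGS B) okA)

pair-χBasis : ∀ λ′ A B → Linked _≥_ λ′ →
  pair (χBasis λ′) (λ C → pair (ΔNCSymBasis C) (indicator (A , B)))
  ≡ χCoeff λ′ ℚ.* ι (𝟙 (multUnion (blockType A) (blockType B) λ′) * shuffleFormula (sum λ′) (A , B))
pair-χBasis λ′ A B λ′↘ = begin
  pair (χBasis λ′) φ
    ≡⟨ pair-map (χCoeff λ′) id (χSupport λ′) φ ⟩
  χCoeff λ′ ℚ.* ∑ℚ (χSupport λ′) φ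
    ≡⟨ cong (χCoeff λ′ ℚ.*_) (∑ℚ-congᴬ (χSupport-isRGS λ′) (λ C → pair-ΔNCSymBasis C (A , B))) ⟩
  χCoeff λ′ ℚ.* (∑ℚ[ C ∈ χSupport λ′ ] ι (splittings C (A , B)))
    ≡⟨ cong (χCoeff λ′ ℚ.*_) (∑ℚ-ι (χSupport λ′) (λ C → splittings C (A , B))) ⟩
  χCoeff λ′ ℚ.* ι (∑[ C ∈ χSupport λ′ ] splittings C (A , B))
    ≡⟨ cong (λ m → χCoeff λ′ ℚ.* ι m) (∑-χSupport-splittings λ′ A B λ′↘) ⟩
  χCoeff λ′ ℚ.* ι (𝟙 (multUnion (blockType A) (blockType B) λ′) * splitCount (sum λ′) (A , B))
    ≡⟨ cong (λ m → χCoeff λ′ ℚ.* ι (𝟙 (multUnion (blockType A) (blockType B) λ′) * m))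
            (splitCount≡shuffleFormula (sum λ′) (A , B)) ⟩
  χCoeff λ′ ℚ.* ι (𝟙 (multUnion (blockType A) (blockType B) λ′) * shuffleFormula (sum λ′) (A , B)) ∎
  where
  φ : List ℕ → ℚ
  φ C = pair (ΔNCSymBasis C) (indicator (A , B))

χ-coproduct-basis : ∀ λ′ A B → IsPartition λ′ →
  pair (χBasis λ′) (λ C → pair (ΔNCSymBasis C) (indicator (A , B)))
  ≡ pair (ΔSymBasis λ′) (λ μν → pair (χ⊗χBasis μν) (indicator (A , B)))
χ-coproduct-basis λ′ A B (λ′↘ , _) = begin
  pair (χBasis λ′) (λ C → pair (ΔNCSymBasis C) (indicator (A , B)))
    ≡⟨ pair-χBasis λ′ A B λ′↘ ⟩
  χCoeff λ′ ℚ.* ι (𝟙 mu * (𝟙 rA * 𝟙 rB * (𝟙 e * (sum λ′ choose length A))))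
    ≡⟨ cong (λ m → χCoeff λ′ ℚ.* ι m) (trans (regroup (𝟙 mu) (𝟙 rA) (𝟙 rB) (𝟙 e) _) (cong (_* _) (sym (𝟙-∧⁴ rA rB mu e)))) ⟩
  χCoeff λ′ ℚ.* ι (𝟙 admissible * (sum λ′ choose length A))
    ≡⟨ *-ι-𝟙 (χCoeff λ′) K admissible (sum λ′ choose length A) scaling ⟩
  K ℚ.* ι (𝟙 admissible)
    ≡⟨ cong (λ m → K ℚ.* ι m) (trans (𝟙-∧⁴ rA rB mu e) (*-assoc (𝟙 rA * 𝟙 rB) (𝟙 mu) (𝟙 e))) ⟩
  K ℚ.* ι (𝟙 rA * 𝟙 rB * (𝟙 mu * 𝟙 e))
    ≡⟨ cong (λ m → K ℚ.* ι m) (coproductCount-≡ λ′ A B) ⟨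
  K ℚ.* ι (coproductCount λ′ A B)
    ≡⟨ pair-ΔSymBasis λ′ A B ⟨
  pair (ΔSymBasis λ′) (λ μν → pair (χ⊗χBasis μν) (indicator (A , B))) ∎
  where
  rA = isRGS A
  rB = isRGS B
  mu = multUnion (blockType A) (blockType B) λ′
  e = length A + length B ≡ᵇ sum λ′
  admissible = ((rA ∧ rB) ∧ mu) ∧ e
  K = χCoeff (blockType A) ℚ.* χCoeff (blockType B)
  regroup : ∀ m a b x c → m * (a * b * (x * c)) ≡ a * b * m * x * c
  regroup = solve-∀
  scaling : admissible ≡ true → χCoeff λ′ ℚ.* ι (sum λ′ choose length A) ≡ K
  scaling adm with ∧-split {(rA ∧ rB) ∧ mu} adm
  ... | rA∧rB∧mu , _ with ∧-split {rA ∧ rB} rA∧rB∧mu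
  ...   | rA∧rB , union = trans
    (cong (λ a → χCoeff λ′ ℚ.* ι (sum λ′ choose a)) (sym (sum-blockType A (proj₁ (∧-split {rA} rA∧rB)))))
    (χCoeff-union λ′ (blockType A) (blockType B) λ′↘ (reflects-sound (multUnion-reflects (blockType A) (blockType B) λ′) union))

mainTheorem16 : (f : List (ℚ × List ℕ)) → All (λ t → IsPartition (proj₂ t)) f →
    (A B : List ℕ) →
    coeff eqPair (ΔNCSym (χ f)) (A , B) ≡ coeff eqPair (χ⊗χ (ΔSym f)) (A , B)
mainTheorem16 f partitions A B = begin
  coeff eqPair (ΔNCSym (χ f)) (A , B)
    ≡⟨ coeff-indicator (ΔNCSym (χ f)) (A , B) ⟩
  pair (linExt ΔNCSymBasis (linExt χBasis f)) (indicator (A , B))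
    ≡⟨ pair-linExt ΔNCSymBasis (linExt χBasis f) (indicator (A , B)) ⟩
  pair (linExt χBasis f) (λ C → pair (ΔNCSymBasis C) (indicator (A , B)))
    ≡⟨ pair-linExt χBasis f _ ⟩
  pair f (λ λ′ → pair (χBasis λ′) (λ C → pair (ΔNCSymBasis C) (indicator (A , B))))
    ≡⟨ pair-congᴬ partitions (λ λ′ λ′-partition → χ-coproduct-basis λ′ A B λ′-partition) ⟩
  pair f (λ λ′ → pair (ΔSymBasis λ′) (λ μν → pair (χ⊗χBasis μν) (indicator (A , B))))
    ≡⟨ pair-linExt ΔSymBasis f _ ⟨
  pair (linExt ΔSymBasis f) (λ μν → pair (χ⊗χBasis μν) (indicator (A , B)))
    ≡⟨ pair-linExt χ⊗χBasis (linExt ΔSymBasis f) (indicator (A , B)) ⟨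
  pair (χ⊗χ (ΔSym f)) (indicator (A , B))
    ≡⟨ coeff-indicator (χ⊗χ (ΔSym f)) (A , B) ⟨
  coeff eqPair (χ⊗χ (ΔSym f)) (A , B) ∎
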